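{- Let $q$ be a prime power and $2\le k\le n$ integers, and let $\mathbb{S}$ be a $q$-Steiner system $S_q(k-1,k,n)$. Let $\mathbb{S}'$ be the multiset $\{B' : B\in\mathbb{S}\}$, where $B'\subseteq\mathbb{F}_q^{n-1}$ is obtained from $B$ by deleting the last coordinate of every vector. Then the $(k-1)$-dimensional members of $\mathbb{S}'$ form a set $\tilde{\mathbb{S}}$ of $\frac{\binom{n-1}{k-2}_q}{\binom{k-1}{k-2}_q}$ distinct $(k-1)$-subspaces which is a $q$-Steiner system $S_q(k-2,k-1,n-1)$, and every $(k-1)$-dimensional subspace of $\mathbb{F}_q^{n-1}$ not belonging to $\tilde{\mathbb{S}}$ is contained in exactly $q^{k-1}$ of the $k$-dimensional members of $\mathbb{S}'$, counted with multiplicity.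
   Context: $\mathbb{F}_q$ is the finite field with $q$ elements. A $q$-Steiner system $S_q(t,k,n)$ is a collection of $k$-dimensional subspaces of $\mathbb{F}_q^n$ (blocks) such that every $t$-dimensional subspace of $\mathbb{F}_q^n$ is contained in exactly one block. The Gaussian coefficient is $\binom{n}{k}_q=\frac{(q^n-1)\cdots(q^{n-k+1}-1)}{(q^k-1)\cdots(q-1)}$, with $\binom{n}{0}_q=1$. -}

module Defs where

open import Level using (Level; 0ℓ)
open import Data.Nat as ℕ using (ℕ; zero; suc; _≤_; _^_)
open import Data.Nat.Primality using (Prime)
open import Data.Fin using (Fin)
import Data.Fin as 𝔽
open import Data.Vec using (Vec; []; _∷_; replicate; zipWith; map; init)
open import Data.Vec.Membership.Propositional using (_∈_)
open import Data.Vec.Relation.Unary.Unique.Propositional using (Unique)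
open import Data.Product using (Σ; ∃; _×_; _,_)
open import Relation.Binary.PropositionalEquality using (_≡_; _≢_)
open import Relation.Nullary using (¬_)
open import Function.Bundles using (_↔_; _⇔_)

IsPrimePower : ℕ → Set
IsPrimePower q = Σ ℕ λ p → Σ ℕ λ e → Prime p × 1 ≤ e × q ≡ p ^ e

record FiniteField (q : ℕ) : Set₁ where
  field
    Carrier : Set
    _+_ _*_ : Carrier → Carrier → Carrier
    -_      : Carrier → Carrier
    0# 1#   : Carrier
    _⁻¹     : Carrier → Carrier
    +-assoc   : ∀ x y z → (x + y) + z ≡ x + (y + z)
    +-comm    : ∀ x y → x + y ≡ y + x
    +-identityˡ : ∀ x → 0# + x ≡ x
    -‿inverseˡ  : ∀ x → (- x) + x ≡ 0#
    *-assoc   : ∀ x y z → (x * y) * z ≡ x * (y * z)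
    *-comm    : ∀ x y → x * y ≡ y * x
    *-identityˡ : ∀ x → 1# * x ≡ x
    distribˡ  : ∀ x y z → x * (y + z) ≡ (x * y) + (x * z)
    0≢1       : 0# ≢ 1#
    ⁻¹-inverseˡ : ∀ x → x ≢ 0# → (x ⁻¹) * x ≡ 1#
    card      : Carrier ↔ Fin q

module LinAlg {q : ℕ} (F : FiniteField q) where
  open FiniteField F

  Vect : ℕ → Set
  Vect n = Vec Carrier n

  zeroV : ∀ {n} → Vect n
  zeroV = replicate _ 0#

  _⊕_ : ∀ {n} → Vect n → Vect n → Vect n
  _⊕_ = zipWith _+_

  _⊙_ : ∀ {n} → Carrier → Vect n → Vect n
  c ⊙ v = map (c *_) v

  lincomb : ∀ {n d} → (Fin d → Carrier) → (Fin d → Vect n) → Vect n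
  lincomb {d = zero}  c b = zeroV
  lincomb {d = suc d} c b =
    (c 𝔽.zero ⊙ b 𝔽.zero) ⊕ lincomb (λ i → c (𝔽.suc i)) (λ i → b (𝔽.suc i))

  LinIndep : ∀ {n d} → (Fin d → Vect n) → Set
  LinIndep {d = d} b = ∀ (c : Fin d → Carrier) → lincomb c b ≡ zeroV → ∀ i → c i ≡ 0#

  InSpan : ∀ {n d} → (Fin d → Vect n) → Vect n → Set
  InSpan {d = d} b v = Σ (Fin d → Carrier) λ c → lincomb c b ≡ v

  Space : ℕ → Set₁
  Space n = Vect n → Set

  HasDim : ∀ {n} → Space n → ℕ → Set
  HasDim {n} U d = Σ (Fin d → Vect n) λ b → LinIndep b × (∀ v → U v ⇔ InSpan b v)

  _⊆_ : ∀ {n} → Space n → Space n → Set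
  U ⊆ W = ∀ v → U v → W v

  _≐_ : ∀ {n} → Space n → Space n → Set
  U ≐ W = ∀ v → U v ⇔ W v

  IsSteiner : (t k n m : ℕ) → (Fin m → Space n) → Set₁
  IsSteiner t k n m B =
    (∀ i → HasDim (B i) k) ×
    (∀ i j → B i ≐ B j → i ≡ j) ×
    (∀ (T : Space n) → HasDim T t →
       Σ (Fin m) λ i → T ⊆ B i × (∀ j → T ⊆ B j → j ≡ i))

  dropLast : ∀ {n} → Vect n → Vect (ℕ.pred n)
  dropLast []       = []
  dropLast (x ∷ xs) = init (x ∷ xs)

  shorten : ∀ {n} → Space n → Space (ℕ.pred n)
  shorten B w = Σ (Vect _) λ v → B v × dropLast v ≡ w

ExactlyN : ∀ {m} → (Fin m → Set) → ℕ → Set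
ExactlyN {m} P N = Σ (Vec (Fin m) N) λ v → Unique v × (∀ i → P i ⇔ (i ∈ v))

-- Gaussian binomial coefficient [n choose k]_q, via the q-Pascal rule
--   [n choose 0] = 1, [0 choose k+1] = 0,
--   [n+1 choose k+1] = [n choose k] + q^(k+1) [n choose k+1]

gauss : ℕ → ℕ → ℕ → ℕ
gauss q n       zero    = 1
gauss q zero    (suc k) = 0
gauss q (suc n) (suc k) = gauss q n k ℕ.+ (q ^ suc k) ℕ.* gauss q n (suc k)

{-# OPTIONS --safe #-}

-- Write vectors of F^n as (w , a) with w ∈ F^(n-1) and a ∈ F, and let eₙ = (0 , 1). Deleting the
-- last coordinate maps a block B onto a space of dimension k - 1 if eₙ ∈ B, and of dimension k
-- otherwise. A block through eₙ contains T × F exactly when its shortening contains T; as T × F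
-- is a (k-1)-space whenever T is a (k-2)-space of F^(n-1), the shortened blocks through eₙ form
-- an S_q(k-2, k-1, n-1). Their number N follows by double counting: every independent
-- (k-2)-tuple of F^(n-1) lies in exactly one of them, so N ∏ᵢ (q^(k-1) - q^i) = ∏ᵢ (q^(n-1) - q^i),
-- and these products are the Gaussian coefficients up to the common factor ∏ᵢ (q^(k-2) - q^i).
-- A (k-1)-space W with basis w outside the derived system has the q^(k-1) lifts spanned by the
-- (w_l , f_l), f ∈ F^(k-1). Each lies in a unique block; that block misses eₙ, since otherwise
-- it would shorten to W, and two lifts differing in some f_l would put eₙ into a common block.

module Submission where

open import Level using (0ℓ)
open import Algebra.Bundles using (CommutativeRing)
open import Algebra.Structures using (IsCommutativeRing)
import Algebra.Consequences.Propositional as Consequences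
import Algebra.Properties.Ring as RingProperties
import Algebra.Properties.CommutativeSemigroup as CommutativeSemigroupProperties
open import Data.Nat as ℕ using (ℕ; zero; suc; _≤_; _<_; _^_; _∸_; z≤n; s≤s; NonZero)
import Data.Nat.Properties as ℕ
open import Data.Nat.Solver using (module +-*-Solver)
open import Data.Fin as Fin using (Fin; zero; suc)
open import Data.List as List using (List; []; _∷_; _++_; length; allFin; filter; cartesianProductWith)
import Data.List.Properties as List
open import Data.List.Relation.Unary.All as All using (All; []; _∷_)
import Data.List.Relation.Unary.Any as Any
open import Data.List.Membership.Propositional using (_∈_)
open import Data.List.Membership.Propositional.Properties
  using (∈-allFin; ∈-map⁺; ∈-map⁻; ∈-filter⁺; ∈-filter⁻; ∈-cartesianProductWith⁺)
open import Data.List.Relation.Unary.Unique.Propositional using (Unique)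
import Data.List.Relation.Unary.Unique.Propositional.Properties as Unique
open import Data.List.Relation.Unary.AllPairs using ([]; _∷_)
open import Data.Vec.Relation.Unary.AllPairs using ([]; _∷_)
open import Data.Vec as Vec using (Vec; []; _∷_; init; last; _∷ʳ_)
import Data.Vec.Properties as Vec
import Data.Vec.Functional as Vector
import Data.Vec.Functional.Properties as Vector
import Data.Vec.Membership.Propositional.Properties as Vec
open import Data.Vec.Relation.Unary.All as VecAll using ([]; _∷_) renaming (All to AllV)
import Data.Vec.Relation.Unary.All.Properties as VecAll
import Data.Vec.Relation.Unary.Unique.Propositional as Vec
open import Data.Vec.Relation.Binary.Pointwise.Extensional using (ext; Pointwise-≡⇒≡)
open import Data.Product using (Σ; ∃; _×_; _,_; proj₁; proj₂)
open import Data.Sum using (inj₁; inj₂)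
open import Data.Empty using (⊥-elim)
open import Data.Unit using (⊤; tt)
open import Function using (_∘_; id)
open import Function.Bundles using (_↔_; _⇔_; mk⇔; Inverse; Injection; Equivalence)
open import Function.Properties.Inverse using (↔-sym; Inverse⇒Injection)
open import Relation.Binary.PropositionalEquality
open import Relation.Binary.Definitions using (DecidableEquality; tri<; tri≈; tri>)
open import Relation.Nullary using (Dec; yes; no; ¬_; ¬?)
open import Relation.Nullary.Decidable using (_×-dec_; map′)
open import Relation.Unary using (Pred; Decidable)

open import Defs

private
  variable
    A B C : Set

∑ : List A → (A → ℕ) → ℕ
∑ []       f = 0
∑ (x ∷ xs) f = f x ℕ.+ ∑ xs f

syntax ∑ xs (λ x → e) = ∑[ x ← xs ] e

∑-cong : ∀ (xs : List A) {f g : A → ℕ} → (∀ x → f x ≡ g x) → ∑ xs f ≡ ∑ xs g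
∑-cong []       f≗g = refl
∑-cong (x ∷ xs) f≗g = cong₂ ℕ._+_ (f≗g x) (∑-cong xs f≗g)

∑-+ : ∀ (xs : List A) (f g : A → ℕ) → ∑[ x ← xs ] (f x ℕ.+ g x) ≡ ∑ xs f ℕ.+ ∑ xs g
∑-+ []       f g = refl
∑-+ (x ∷ xs) f g = trans (cong (f x ℕ.+ g x ℕ.+_) (∑-+ xs f g)) (+-interchange (f x) (g x) _ _)
  where open CommutativeSemigroupProperties ℕ.+-commutativeSemigroup renaming (interchange to +-interchange)

∑-*ˡ : ∀ (xs : List A) c (f : A → ℕ) → ∑[ x ← xs ] (c ℕ.* f x) ≡ c ℕ.* ∑ xs f
∑-*ˡ []       c f = sym (ℕ.*-zeroʳ c)
∑-*ˡ (x ∷ xs) c f = trans (cong (c ℕ.* f x ℕ.+_) (∑-*ˡ xs c f)) (sym (ℕ.*-distribˡ-+ c (f x) _))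

∑-zero : ∀ (xs : List A) → ∑[ x ← xs ] 0 ≡ 0
∑-zero []       = refl
∑-zero (x ∷ xs) = ∑-zero xs

∑-one : ∀ (xs : List A) → ∑[ x ← xs ] 1 ≡ length xs
∑-one []       = refl
∑-one (x ∷ xs) = cong suc (∑-one xs)

∑-++ : ∀ (xs ys : List A) (f : A → ℕ) → ∑ (xs ++ ys) f ≡ ∑ xs f ℕ.+ ∑ ys f
∑-++ []       ys f = refl
∑-++ (x ∷ xs) ys f = trans (cong (f x ℕ.+_) (∑-++ xs ys f)) (sym (ℕ.+-assoc (f x) _ _))

∑-map : ∀ (g : A → B) (xs : List A) (f : B → ℕ) → ∑ (List.map g xs) f ≡ ∑[ x ← xs ] f (g x)
∑-map g []       f = refl
∑-map g (x ∷ xs) f = cong (f (g x) ℕ.+_) (∑-map g xs f)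

∑-comm : ∀ (xs : List A) (ys : List B) (f : A → B → ℕ) →
         ∑[ x ← xs ] ∑[ y ← ys ] f x y ≡ ∑[ y ← ys ] ∑[ x ← xs ] f x y
∑-comm []       ys f = sym (∑-zero ys)
∑-comm (x ∷ xs) ys f = trans (cong (∑ ys (f x) ℕ.+_) (∑-comm xs ys f)) (sym (∑-+ ys (f x) _))

∑-cartesianProductWith : ∀ (g : A → B → C) (xs : List A) (ys : List B) (f : C → ℕ) →
  ∑ (cartesianProductWith g xs ys) f ≡ ∑[ x ← xs ] ∑[ y ← ys ] f (g x y)
∑-cartesianProductWith g []       ys f = refl
∑-cartesianProductWith g (x ∷ xs) ys f = begin
  ∑ (List.map (g x) ys ++ cartesianProductWith g xs ys) f         ≡⟨ ∑-++ (List.map (g x) ys) _ f ⟩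
  ∑ (List.map (g x) ys) f ℕ.+ ∑ (cartesianProductWith g xs ys) f
    ≡⟨ cong₂ ℕ._+_ (∑-map (g x) ys f) (∑-cartesianProductWith g xs ys f) ⟩
  ∑[ y ← ys ] f (g x y) ℕ.+ ∑[ x ← xs ] ∑[ y ← ys ] f (g x y)     ∎
  where open ≡-Reasoning

length-cartesianProductWith : ∀ (g : A → B → C) (xs : List A) (ys : List B) →
  length (cartesianProductWith g xs ys) ≡ length xs ℕ.* length ys
length-cartesianProductWith g []       ys = refl
length-cartesianProductWith g (x ∷ xs) ys = begin
  length (List.map (g x) ys ++ cartesianProductWith g xs ys)  ≡⟨ List.length-++ (List.map (g x) ys) ⟩
  length (List.map (g x) ys) ℕ.+ length (cartesianProductWith g xs ys)
    ≡⟨ cong₂ ℕ._+_ (List.length-map (g x) ys) (length-cartesianProductWith g xs ys) ⟩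
  length ys ℕ.+ length xs ℕ.* length ys  ∎
  where open ≡-Reasoning

indicator : {X : Set} → Dec X → ℕ
indicator (yes _) = 1
indicator (no _)  = 0

module _ {X Y : Set} where

  indicator-cong : (X → Y) → (Y → X) → (x? : Dec X) (y? : Dec Y) → indicator x? ≡ indicator y?
  indicator-cong f g (yes _) (yes _) = refl
  indicator-cong f g (yes x) (no ¬y) = ⊥-elim (¬y (f x))
  indicator-cong f g (no ¬x) (yes y) = ⊥-elim (¬x (g y))
  indicator-cong f g (no _)  (no _)  = refl

  indicator-× : (x? : Dec X) (y? : Dec Y) → indicator (x? ×-dec y?) ≡ indicator x? ℕ.* indicator y?
  indicator-× (yes _) (yes _) = refl
  indicator-× (yes _) (no _)  = refl
  indicator-× (no _)  _       = refl

indicator-yes : {X : Set} (x? : Dec X) → X → indicator x? ≡ 1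
indicator-yes (yes _) _ = refl
indicator-yes (no ¬x) x = ⊥-elim (¬x x)

indicator-no : {X : Set} (x? : Dec X) → ¬ X → indicator x? ≡ 0
indicator-no (yes x) ¬x = ⊥-elim (¬x x)
indicator-no (no _)  _  = refl

count : {P : Pred A 0ℓ} → Decidable P → List A → ℕ
count P? xs = ∑[ x ← xs ] indicator (P? x)

module _ {P : Pred A 0ℓ} (P? : Decidable P) where

  count-cong : {Q : Pred A 0ℓ} (Q? : Decidable Q) (xs : List A) → (∀ x → P x → Q x) → (∀ x → Q x → P x) →
               count P? xs ≡ count Q? xs
  count-cong Q? xs f g = ∑-cong xs (λ x → indicator-cong (f x) (g x) (P? x) (Q? x))

  count-none : ∀ {xs} → All (¬_ ∘ P) xs → count P? xs ≡ 0
  count-none {[]}     []          = refl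
  count-none {x ∷ xs} (¬px ∷ ¬ps) = trans (cong (ℕ._+ count P? xs) (indicator-no (P? x) ¬px)) (count-none ¬ps)

  count-pos : ∀ {x xs} → x ∈ xs → P x → 0 < count P? xs
  count-pos {xs = y ∷ ys} (Any.here refl) px rewrite indicator-yes (P? y) px = s≤s z≤n
  count-pos {xs = y ∷ ys} (Any.there x∈) px = ℕ.≤-trans (count-pos x∈ px) (ℕ.m≤n+m _ (indicator (P? y)))

  count-witness : ∀ xs → 0 < count P? xs → ∃ λ x → x ∈ xs × P x
  count-witness (x ∷ xs) pos with P? x
  ... | yes px = x , Any.here refl , px
  ... | no _   = let y , y∈ , py = count-witness xs pos in y , Any.there y∈ , py

  count-split : {Q : Pred A 0ℓ} (Q? : Decidable Q) (xs : List A) → (∀ x → Q x → P x) →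
                count P? xs ≡ count Q? xs ℕ.+ count (λ x → P? x ×-dec ¬? (Q? x)) xs
  count-split Q? xs Q⊆P = trans (∑-cong xs split) (∑-+ xs _ _)
    where
    split : ∀ x → indicator (P? x) ≡ indicator (Q? x) ℕ.+ indicator (P? x ×-dec ¬? (Q? x))
    split x with P? x | Q? x
    ... | yes _ | yes _ = refl
    ... | yes _ | no _  = refl
    ... | no ¬p | yes q = ⊥-elim (¬p (Q⊆P x q))
    ... | no _  | no _  = refl

  length-filter : ∀ xs → length (filter P? xs) ≡ count P? xs
  length-filter []       = refl
  length-filter (x ∷ xs) with P? x
  ... | yes _ = cong suc (length-filter xs)
  ... | no _  = length-filter xs

count-≟-unique : (_≟_ : DecidableEquality A) {xs : List A} → Unique xs → ∀ {a} → a ∈ xs → count (_≟ a) xs ≡ 1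
count-≟-unique _≟_ {x ∷ xs} (x∉xs ∷ _) (Any.here refl) =
  cong₂ ℕ._+_ (indicator-yes (x ≟ x) refl) (count-none (_≟ x) (All.map (λ x≢y y≡x → x≢y (sym y≡x)) x∉xs))
count-≟-unique _≟_ {x ∷ xs} (x∉xs ∷ u) (Any.there a∈xs) =
  cong₂ ℕ._+_ (indicator-no (x ≟ _) (All.lookup x∉xs a∈xs)) (count-≟-unique _≟_ u a∈xs)

record Finite (A : Set) : Set where
  field
    elements : List A
    unique   : Unique elements
    complete : ∀ a → a ∈ elements
    _≟_      : DecidableEquality A

  size : ℕ
  size = length elements

  count-≟ : ∀ a → count (_≟ a) elements ≡ 1
  count-≟ a = count-≟-unique _≟_ unique (complete a)

  count-enumerated : {P : Pred A 0ℓ} (P? : Decidable P) {ys : List A} → Unique ys → (∀ a → P a ⇔ a ∈ ys) →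
                     count P? elements ≡ length ys
  count-enumerated P? {ys} ys-unique P⇔∈ = begin
    ∑[ a ← elements ] indicator (P? a)                   ≡⟨ ∑-cong elements occurrences ⟩
    ∑[ a ← elements ] ∑[ y ← ys ] indicator (y ≟ a)      ≡⟨ ∑-comm elements ys _ ⟩
    ∑[ y ← ys ] ∑[ a ← elements ] indicator (y ≟ a)
      ≡⟨ ∑-cong ys (λ y → trans (count-cong (y ≟_) (_≟ y) elements (λ _ → sym) (λ _ → sym)) (count-≟ y)) ⟩
    ∑[ y ← ys ] 1                                         ≡⟨ ∑-one ys ⟩
    length ys                                             ∎
    where
    open ≡-Reasoning
    occurrences : ∀ a → indicator (P? a) ≡ count (_≟ a) ys
    occurrences a with P? a
    ... | yes p = sym (count-≟-unique _≟_ ys-unique (Equivalence.to (P⇔∈ a) p))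
    ... | no ¬p = sym (count-none (_≟ a) (All.tabulate (λ y∈ys y≡a → ¬p (Equivalence.from (P⇔∈ a) (subst (_∈ ys) y≡a y∈ys)))))

open Finite using (elements; unique; complete; size)

Fin-finite : ∀ m → Finite (Fin m)
Fin-finite m = record { elements = allFin m ; unique = Unique.allFin⁺ m ; complete = ∈-allFin ; _≟_ = Fin._≟_ }

size-Fin-finite : ∀ m → size (Fin-finite m) ≡ m
size-Fin-finite m = List.length-tabulate id

↔-injective : (A↔B : A ↔ B) → ∀ {a a′} → Inverse.to A↔B a ≡ Inverse.to A↔B a′ → a ≡ a′
↔-injective A↔B = Injection.injective (Inverse⇒Injection A↔B)

↔-finite : A ↔ B → Finite A → Finite B
↔-finite A↔B finA = record
  { elements = List.map to (elements finA)
  ; unique   = Unique.map⁺ (↔-injective A↔B) (unique finA)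
  ; complete = λ b → subst (_∈ _) (strictlyInverseˡ b) (∈-map⁺ to (complete finA (from b)))
  ; _≟_      = λ a b → map′ (↔-injective (↔-sym A↔B)) (cong from) (Finite._≟_ finA (from a) (from b))
  }
  where open Inverse A↔B

size-↔-finite : (A↔B : A ↔ B) (finA : Finite A) → size (↔-finite A↔B finA) ≡ size finA
size-↔-finite A↔B finA = List.length-map (Inverse.to A↔B) (elements finA)

vectors : List A → ∀ n → List (Vec A n)
vectors xs zero    = [] ∷ []
vectors xs (suc n) = cartesianProductWith _∷_ xs (vectors xs n)

Vec-finite : Finite A → ∀ n → Finite (Vec A n)
Vec-finite finA n = record
  { elements = vectors (elements finA) n
  ; unique   = vectors-unique n
  ; complete = vectors-complete
  ; _≟_      = Vec.≡-dec (Finite._≟_ finA)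
  }
  where
  vectors-unique : ∀ n → Unique (vectors (elements finA) n)
  vectors-unique zero    = [] ∷ []
  vectors-unique (suc n) = Unique.cartesianProductWith⁺ _∷_ Vec.∷-injective (unique finA) (vectors-unique n)
  vectors-complete : ∀ {n} (v : Vec _ n) → v ∈ vectors (elements finA) n
  vectors-complete []      = Any.here refl
  vectors-complete (x ∷ v) = ∈-cartesianProductWith⁺ _∷_ (complete finA x) (vectors-complete v)

size-Vec-finite : (finA : Finite A) → ∀ n → size (Vec-finite finA n) ≡ size finA ^ n
size-Vec-finite finA zero    = refl
size-Vec-finite finA (suc n) =
  trans (length-cartesianProductWith _∷_ (elements finA) _) (cong (size finA ℕ.*_) (size-Vec-finite finA n))

distinct⇒1< : ∀ {n} (i j : Fin n) → i ≢ j → 1 < n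
distinct⇒1< {suc zero}    zero zero i≢j = ⊥-elim (i≢j refl)
distinct⇒1< {suc (suc n)} _    _    _   = s≤s (s≤s z≤n)

Unique-fromList : {xs : List A} → Unique xs → Vec.Unique (Vec.fromList xs)
Unique-fromList []           = []
Unique-fromList (x∉xs ∷ u) = VecAll.fromList⁺ x∉xs ∷ Unique-fromList u

exactlyN-fromList : ∀ {m} {P : Fin m → Set} {ys : List (Fin m)} → Unique ys → (∀ i → P i ⇔ i ∈ ys) →
                    ExactlyN P (length ys)
exactlyN-fromList {ys = ys} u P⇔∈ = Vec.fromList ys , Unique-fromList u ,
  λ i → mk⇔ (Vec.∈-fromList⁺ ∘ Equivalence.to (P⇔∈ i)) (Equivalence.from (P⇔∈ i) ∘ Vec.∈-fromList⁻)

-- Gaussian coefficients as quotients of counts of independent tuples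

indepTuples : ℕ → ℕ → ℕ → ℕ
indepTuples q e zero    = 1
indepTuples q e (suc j) = (q ^ e ∸ q ^ j) ℕ.* indepTuples q e j

module _ (q : ℕ) where
  open import Data.Nat using (_+_; _*_)
  open +-*-Solver using (solve; _:+_; _:*_; _:=_; con)
  open ≡-Reasoning

  indepTuples-suc : ∀ e j → indepTuples q (suc e) (suc j) ≡ (q ^ suc e ∸ 1) * (q ^ j * indepTuples q e j)
  indepTuples-suc e zero    = refl
  indepTuples-suc e (suc j) = begin
    (q ^ suc e ∸ q ^ suc j) * indepTuples q (suc e) (suc j)
      ≡⟨ cong₂ _*_ (sym (ℕ.*-distribˡ-∸ q (q ^ e) (q ^ j))) (indepTuples-suc e j) ⟩
    (q * D) * (K * (Q * P))
      ≡⟨ solve 5 (λ q D K Q P → (q :* D) :* (K :* (Q :* P)) := K :* ((q :* Q) :* (D :* P))) refl q D K Q P ⟩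
    K * ((q * Q) * (D * P)) ∎
    where
    K = q ^ suc e ∸ 1
    Q = q ^ j
    D = q ^ e ∸ q ^ j
    P = indepTuples q e j

  indepTuples-≡0 : ∀ {e j} → e < j → indepTuples q e j ≡ 0
  indepTuples-≡0 {e} {suc j} (s≤s e≤j) with ℕ.m≤n⇒m<n∨m≡n e≤j
  ... | inj₁ e<j  = trans (cong ((q ^ e ∸ q ^ j) *_) (indepTuples-≡0 e<j)) (ℕ.*-zeroʳ (q ^ e ∸ q ^ j))
  ... | inj₂ refl = cong (_* indepTuples q e e) (ℕ.n∸n≡0 (q ^ e))

  module _ .{{_ : NonZero q}} where

    -- The q-Pascal rule of gauss, multiplied through by indepTuples q (suc j) (suc j).
    indepTuples-pascal : ∀ e j → let P = indepTuples q e j in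
      indepTuples q (suc e) (suc j) ≡ (q ^ suc j ∸ 1) * (q ^ j * P) + (q * q ^ j) * ((q ^ e ∸ q ^ j) * P)
    indepTuples-pascal e j with ℕ.≤-<-connex j e
    ... | inj₁ j≤e = begin
      indepTuples q (suc e) (suc j)    ≡⟨ indepTuples-suc e j ⟩
      (q ^ suc e ∸ 1) * (Q * P)        ≡⟨ cong (_* (Q * P)) split ⟩
      (K + q * D) * (Q * P)
        ≡⟨ solve 5 (λ K q D Q P → (K :+ q :* D) :* (Q :* P) := K :* (Q :* P) :+ (q :* Q) :* (D :* P)) refl K q D Q P ⟩
      K * (Q * P) + (q * Q) * (D * P)  ∎
      where
      K = q ^ suc j ∸ 1
      Q = q ^ j
      D = q ^ e ∸ q ^ j
      P = indepTuples q e j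
      split : q ^ suc e ∸ 1 ≡ K + q * D
      split with q ^ suc j | ℕ.m^n>0 q (suc j) | ℕ.^-monoʳ-≤ q (s≤s j≤e) | ℕ.*-distribˡ-∸ q (q ^ e) (q ^ j)
      ... | suc a | _ | q^[1+j]≤q^[1+e] | qD≡ = trans (cong (_∸ 1) (sym (ℕ.m+[n∸m]≡n q^[1+j]≤q^[1+e]))) (cong (a +_) (sym qD≡))
    ... | inj₂ e<j = begin
      indepTuples q (suc e) (suc j)  ≡⟨ indepTuples-≡0 (s≤s e<j) ⟩
      0                              ≡⟨ solve 4 (λ K Q q D → con 0 := K :* (Q :* con 0) :+ (q :* Q) :* (D :* con 0)) refl K Q q D ⟩
      K * (Q * 0) + (q * Q) * (D * 0) ≡⟨ cong (λ P → K * (Q * P) + (q * Q) * (D * P)) (sym (indepTuples-≡0 e<j)) ⟩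
      K * (Q * P) + (q * Q) * (D * P) ∎
      where
      K = q ^ suc j ∸ 1
      Q = q ^ j
      D = q ^ e ∸ q ^ j
      P = indepTuples q e j

    gauss-*-indepTuples : ∀ e j → gauss q e j * indepTuples q j j ≡ indepTuples q e j
    gauss-*-indepTuples e       zero    = refl
    gauss-*-indepTuples zero    (suc j) = sym (cong (_* indepTuples q 0 j) (ℕ.m≤n⇒m∸n≡0 (ℕ.m^n>0 q j)))
    gauss-*-indepTuples (suc e) (suc j) = begin
      (g₁ + (q * Q) * g₂) * indepTuples q (suc j) (suc j)
        ≡⟨ cong ((g₁ + (q * Q) * g₂) *_) (indepTuples-suc j j) ⟩
      (g₁ + (q * Q) * g₂) * (K * (Q * Pⱼ))
        ≡⟨ solve 6 (λ g₁ g₂ q Q K Pⱼ → (g₁ :+ (q :* Q) :* g₂) :* (K :* (Q :* Pⱼ))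
                                  := K :* (Q :* (g₁ :* Pⱼ)) :+ (q :* Q) :* (g₂ :* (K :* (Q :* Pⱼ))))
                   refl g₁ g₂ q Q K Pⱼ ⟩
      K * (Q * (g₁ * Pⱼ)) + (q * Q) * (g₂ * (K * (Q * Pⱼ)))
        ≡⟨ cong₂ (λ x y → K * (Q * x) + (q * Q) * (g₂ * y)) (gauss-*-indepTuples e j) (sym (indepTuples-suc j j)) ⟩
      K * (Q * P) + (q * Q) * (g₂ * indepTuples q (suc j) (suc j))
        ≡⟨ cong (λ x → K * (Q * P) + (q * Q) * x) (gauss-*-indepTuples e (suc j)) ⟩
      K * (Q * P) + (q * Q) * ((q ^ e ∸ Q) * P)
        ≡⟨ sym (indepTuples-pascal e j) ⟩
      indepTuples q (suc e) (suc j) ∎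
      where
      g₁ = gauss q e j
      g₂ = gauss q e (suc j)
      K = q ^ suc j ∸ 1
      Q = q ^ j
      P = indepTuples q e j
      Pⱼ = indepTuples q j j

module _ {q : ℕ} (1<q : 1 < q) where
  open import Data.Nat using (_*_)

  private instance
    q≢0 : NonZero q
    q≢0 = ℕ.>-nonZero (ℕ.<-trans (s≤s z≤n) 1<q)

  indepTuples-pos : ∀ j → 0 < indepTuples q j j
  indepTuples-pos zero    = s≤s z≤n
  indepTuples-pos (suc j) rewrite indepTuples-suc q j j =
    ℕ.*-mono-≤ (ℕ.m<n⇒0<n∸m (ℕ.^-monoʳ-< q 1<q {0} {suc j} (s≤s z≤n))) (ℕ.*-mono-≤ (ℕ.m^n>0 q j) (indepTuples-pos j))

  gauss-quotient : ∀ {N a b j} → N * indepTuples q a j ≡ indepTuples q b j → N * gauss q a j ≡ gauss q b j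
  gauss-quotient {N} {a} {b} {j} N*Pₐ≡P_b =
    ℕ.*-cancelʳ-≡ (N * gauss q a j) (gauss q b j) (indepTuples q j j) {{ℕ.>-nonZero (indepTuples-pos j)}} (begin
      N * gauss q a j * indepTuples q j j    ≡⟨ ℕ.*-assoc N _ _ ⟩
      N * (gauss q a j * indepTuples q j j)  ≡⟨ cong (N *_) (gauss-*-indepTuples q a j) ⟩
      N * indepTuples q a j                  ≡⟨ N*Pₐ≡P_b ⟩
      indepTuples q b j                      ≡⟨ gauss-*-indepTuples q b j ⟨
      gauss q b j * indepTuples q j j        ∎)
    where open ≡-Reasoning

^-injective : ∀ {q a b} → 1 < q → q ^ a ≡ q ^ b → a ≡ b
^-injective {q} {a} {b} 1<q qᵃ≡qᵇ with ℕ.<-cmp a b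
... | tri< a<b _ _ = ⊥-elim (ℕ.<-irrefl qᵃ≡qᵇ (ℕ.^-monoʳ-< q 1<q a<b))
... | tri≈ _ a≡b _ = a≡b
... | tri> _ _ b<a = ⊥-elim (ℕ.<-irrefl (sym qᵃ≡qᵇ) (ℕ.^-monoʳ-< q 1<q b<a))

module _ {q : ℕ} (F : FiniteField q) where
  open FiniteField F
  open LinAlg F

  +-*-isCommutativeRing : IsCommutativeRing _≡_ _+_ _*_ -_ 0# 1#
  +-*-isCommutativeRing = record
    { isRing = record
      { +-isAbelianGroup = record
        { isGroup = record
          { isMonoid = record
            { isSemigroup = record
              { isMagma = record { isEquivalence = isEquivalence ; ∙-cong = cong₂ _+_ }
              ; assoc   = +-assoc
              }
            ; identity = +-identityˡ , Consequences.comm∧idˡ⇒idʳ +-comm +-identityˡ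
            }
          ; inverse = -‿inverseˡ , Consequences.comm∧invˡ⇒invʳ +-comm -‿inverseˡ
          ; ⁻¹-cong = cong -_
          }
        ; comm = +-comm
        }
      ; *-cong     = cong₂ _*_
      ; *-assoc    = *-assoc
      ; *-identity = *-identityˡ , Consequences.comm∧idˡ⇒idʳ *-comm *-identityˡ
      ; distrib    = distribˡ , Consequences.comm∧distrˡ⇒distrʳ *-comm distribˡ
      }
    ; *-comm = *-comm
    }

  +-*-commutativeRing : CommutativeRing 0ℓ 0ℓ
  +-*-commutativeRing = record { isCommutativeRing = +-*-isCommutativeRing }

  open CommutativeRing +-*-commutativeRing using (zeroˡ; zeroʳ; +-identityʳ; *-identityʳ; distribʳ; -‿inverseʳ)
  open RingProperties (CommutativeRing.ring +-*-commutativeRing)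
    using (-1*x≈-x; +-inverseˡ-unique; x∙y⁻¹≈ε⇒x≈y; -‿involutive; -0#≈0#)

  -1≢0 : - 1# ≢ 0#
  -1≢0 -1≡0 = 0≢1 (sym (trans (sym (-‿involutive 1#)) (trans (cong -_ -1≡0) -0#≈0#)))

  Carrier-finite : Finite Carrier
  Carrier-finite = ↔-finite (↔-sym card) (Fin-finite q)

  open Finite Carrier-finite using (_≟_)

  1<q : 1 < q
  1<q = distinct⇒1< (Inverse.to card 0#) (Inverse.to card 1#) (0≢1 ∘ ↔-injective card)

  ⊕-assoc : ∀ {n} (u v w : Vect n) → (u ⊕ v) ⊕ w ≡ u ⊕ (v ⊕ w)
  ⊕-assoc = Vec.zipWith-assoc +-assoc

  ⊕-comm : ∀ {n} (u v : Vect n) → u ⊕ v ≡ v ⊕ u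
  ⊕-comm = Vec.zipWith-comm +-comm

  ⊕-identityˡ : ∀ {n} (v : Vect n) → zeroV ⊕ v ≡ v
  ⊕-identityˡ = Vec.zipWith-identityˡ +-identityˡ

  ⊕-identityʳ : ∀ {n} (v : Vect n) → v ⊕ zeroV ≡ v
  ⊕-identityʳ = Vec.zipWith-identityʳ +-identityʳ

  ⊙-distribˡ : ∀ {n} a (u v : Vect n) → a ⊙ (u ⊕ v) ≡ (a ⊙ u) ⊕ (a ⊙ v)
  ⊙-distribˡ a []      []      = refl
  ⊙-distribˡ a (x ∷ u) (y ∷ v) = cong₂ _∷_ (distribˡ a x y) (⊙-distribˡ a u v)

  ⊙-distribʳ : ∀ {n} a b (v : Vect n) → (a + b) ⊙ v ≡ (a ⊙ v) ⊕ (b ⊙ v)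
  ⊙-distribʳ a b []      = refl
  ⊙-distribʳ a b (x ∷ v) = cong₂ _∷_ (distribʳ x a b) (⊙-distribʳ a b v)

  ⊙-assoc : ∀ {n} a b (v : Vect n) → (a * b) ⊙ v ≡ a ⊙ (b ⊙ v)
  ⊙-assoc a b v = trans (Vec.map-cong (*-assoc a b) v) (Vec.map-∘ (a *_) (b *_) v)

  ⊙-identityˡ : ∀ {n} (v : Vect n) → 1# ⊙ v ≡ v
  ⊙-identityˡ v = trans (Vec.map-cong *-identityˡ v) (Vec.map-id v)

  ⊙-zeroˡ : ∀ {n} (v : Vect n) → 0# ⊙ v ≡ zeroV
  ⊙-zeroˡ []      = refl
  ⊙-zeroˡ (x ∷ v) = cong₂ _∷_ (zeroˡ x) (⊙-zeroˡ v)

  ⊙-zeroʳ : ∀ {n} a → a ⊙ zeroV {n} ≡ zeroV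
  ⊙-zeroʳ {n} a = trans (Vec.map-replicate (a *_) 0# n) (cong (Vec.replicate n) (zeroʳ a))

  ⊙-⁻¹-cancel : ∀ {n} {a} → a ≢ 0# → (v : Vect n) → (a ⁻¹) ⊙ (a ⊙ v) ≡ v
  ⊙-⁻¹-cancel {a = a} a≢0 v = begin
    (a ⁻¹) ⊙ (a ⊙ v) ≡⟨ ⊙-assoc (a ⁻¹) a v ⟨
    ((a ⁻¹) * a) ⊙ v ≡⟨ cong (_⊙ v) (⁻¹-inverseˡ a a≢0) ⟩
    1# ⊙ v           ≡⟨ ⊙-identityˡ v ⟩
    v                ∎
    where open ≡-Reasoning

  ⊕-inverseˡ-unique : ∀ {n} (u w : Vect n) → u ⊕ w ≡ zeroV → u ≡ (- 1#) ⊙ w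
  ⊕-inverseˡ-unique []      []      _   = refl
  ⊕-inverseˡ-unique (x ∷ u) (y ∷ w) x+y≡0 =
    cong₂ _∷_ (trans (+-inverseˡ-unique x y (Vec.∷-injectiveˡ x+y≡0)) (sym (-1*x≈-x y)))
              (⊕-inverseˡ-unique u w (Vec.∷-injectiveʳ x+y≡0))

  ⊕-inverseʳ : ∀ {n} (v : Vect n) → v ⊕ ((- 1#) ⊙ v) ≡ zeroV
  ⊕-inverseʳ []      = refl
  ⊕-inverseʳ (x ∷ v) = cong₂ _∷_ (trans (cong (x +_) (-1*x≈-x x)) (-‿inverseʳ x)) (⊕-inverseʳ v)

  lincomb-cong : ∀ {n d} {c c′ : Fin d → Carrier} {b b′ : Fin d → Vect n} →
                 (∀ i → c i ≡ c′ i) → (∀ i → b i ≡ b′ i) → lincomb c b ≡ lincomb c′ b′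
  lincomb-cong {d = zero}  c≗c′ b≗b′ = refl
  lincomb-cong {d = suc d} c≗c′ b≗b′ =
    cong₂ _⊕_ (cong₂ _⊙_ (c≗c′ zero) (b≗b′ zero)) (lincomb-cong (c≗c′ ∘ suc) (b≗b′ ∘ suc))

  lincomb-zeroˡ : ∀ {n d} (b : Fin d → Vect n) → lincomb (λ _ → 0#) b ≡ zeroV
  lincomb-zeroˡ {d = zero}  b = refl
  lincomb-zeroˡ {d = suc d} b = trans (cong₂ _⊕_ (⊙-zeroˡ (b zero)) (lincomb-zeroˡ (b ∘ suc))) (⊕-identityˡ zeroV)

  lincomb-zeroʳ : ∀ {n d} (c : Fin d → Carrier) → lincomb c (λ _ → zeroV {n}) ≡ zeroV
  lincomb-zeroʳ {d = zero}  c = refl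
  lincomb-zeroʳ {d = suc d} c = trans (cong₂ _⊕_ (⊙-zeroʳ (c zero)) (lincomb-zeroʳ (c ∘ suc))) (⊕-identityˡ zeroV)

  lincomb-+ : ∀ {n d} (c c′ : Fin d → Carrier) (b : Fin d → Vect n) →
              lincomb (λ i → c i + c′ i) b ≡ lincomb c b ⊕ lincomb c′ b
  lincomb-+ {d = zero}  c c′ b = sym (⊕-identityˡ zeroV)
  lincomb-+ {d = suc d} c c′ b = begin
    ((c zero + c′ zero) ⊙ b zero) ⊕ lincomb (λ i → c (suc i) + c′ (suc i)) (b ∘ suc)
      ≡⟨ cong₂ _⊕_ (⊙-distribʳ (c zero) (c′ zero) (b zero)) (lincomb-+ (c ∘ suc) (c′ ∘ suc) (b ∘ suc)) ⟩
    (x ⊕ x′) ⊕ (y ⊕ y′)  ≡⟨ ⊕-interchange x x′ y y′ ⟩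
    (x ⊕ y) ⊕ (x′ ⊕ y′)  ∎
    where
    open ≡-Reasoning
    ⊕-interchange = Consequences.comm∧assoc⇒middleFour ⊕-comm ⊕-assoc
    x  = c zero ⊙ b zero
    x′ = c′ zero ⊙ b zero
    y  = lincomb (c ∘ suc) (b ∘ suc)
    y′ = lincomb (c′ ∘ suc) (b ∘ suc)

  lincomb-* : ∀ {n d} a (c : Fin d → Carrier) (b : Fin d → Vect n) →
              lincomb (λ i → a * c i) b ≡ a ⊙ lincomb c b
  lincomb-* {d = zero}  a c b = sym (⊙-zeroʳ a)
  lincomb-* {d = suc d} a c b =
    trans (cong₂ _⊕_ (⊙-assoc a (c zero) (b zero)) (lincomb-* a (c ∘ suc) (b ∘ suc))) (sym (⊙-distribˡ a _ _))

  δ : ∀ {d} → Fin d → Fin d → Carrier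
  δ zero    zero    = 1#
  δ zero    (suc _) = 0#
  δ (suc j) zero    = 0#
  δ (suc j) (suc i) = δ j i

  lincomb-δ : ∀ {n d} (b : Fin d → Vect n) j → lincomb (δ j) b ≡ b j
  lincomb-δ {d = suc d} b zero    = trans (cong₂ _⊕_ (⊙-identityˡ (b zero)) (lincomb-zeroˡ (b ∘ suc))) (⊕-identityʳ _)
  lincomb-δ {d = suc d} b (suc j) = trans (cong₂ _⊕_ (⊙-zeroˡ (b zero)) (lincomb-δ (b ∘ suc) j)) (⊕-identityˡ _)

  lincomb-++ : ∀ {n r j} (u : Vec (Vect n) r) (t : Vec (Vect n) j) (c : Fin (r ℕ.+ j) → Carrier) →
               lincomb c (Vec.lookup (u Vec.++ t))
                 ≡ lincomb (c ∘ (Fin._↑ˡ j)) (Vec.lookup u) ⊕ lincomb (c ∘ (r Fin.↑ʳ_)) (Vec.lookup t)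
  lincomb-++ []      t c = sym (⊕-identityˡ _)
  lincomb-++ (x ∷ u) t c = trans (cong ((c zero ⊙ x) ⊕_) (lincomb-++ u t (c ∘ suc))) (sym (⊕-assoc _ _ _))

  module _ {n d : ℕ} (b : Fin d → Vect n) where

    InSpan-zero : InSpan b zeroV
    InSpan-zero = (λ _ → 0#) , lincomb-zeroˡ b

    InSpan-⊕ : ∀ {u v} → InSpan b u → InSpan b v → InSpan b (u ⊕ v)
    InSpan-⊕ (c , refl) (c′ , refl) = (λ i → c i + c′ i) , lincomb-+ c c′ b

    InSpan-⊙ : ∀ a {v} → InSpan b v → InSpan b (a ⊙ v)
    InSpan-⊙ a (c , refl) = (λ i → a * c i) , lincomb-* a c b

    InSpan-member : ∀ j → InSpan b (b j)
    InSpan-member j = δ j , lincomb-δ b j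

    InSpan-lincomb : ∀ {e} (u : Fin e → Vect n) (c : Fin e → Carrier) → (∀ i → InSpan b (u i)) → InSpan b (lincomb c u)
    InSpan-lincomb {zero}  u c u⊆b = InSpan-zero
    InSpan-lincomb {suc e} u c u⊆b = InSpan-⊕ (InSpan-⊙ (c zero) (u⊆b zero)) (InSpan-lincomb (u ∘ suc) (c ∘ suc) (u⊆b ∘ suc))

    LinIndep-injective : LinIndep b → ∀ (c c′ : Fin d → Carrier) → lincomb c b ≡ lincomb c′ b → ∀ i → c i ≡ c′ i
    LinIndep-injective indep c c′ c≡c′ i = x∙y⁻¹≈ε⇒x≈y (c i) (c′ i) (indep (λ i → c i + (- c′ i)) difference≡0 i)
      where
      open ≡-Reasoning
      difference≡0 : lincomb (λ i → c i + (- c′ i)) b ≡ zeroV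
      difference≡0 = begin
        lincomb (λ i → c i + (- c′ i)) b          ≡⟨ lincomb-+ c (λ i → - c′ i) b ⟩
        lincomb c b ⊕ lincomb (λ i → - c′ i) b  ≡⟨ cong (_⊕ lincomb (λ i → - c′ i) b) c≡c′ ⟩
        lincomb c′ b ⊕ lincomb (λ i → - c′ i) b ≡⟨ lincomb-+ c′ (λ i → - c′ i) b ⟨
        lincomb (λ i → c′ i + (- c′ i)) b         ≡⟨ lincomb-cong (-‿inverseʳ ∘ c′) (λ _ → refl) ⟩
        lincomb (λ _ → 0#) b                    ≡⟨ lincomb-zeroˡ b ⟩
        zeroV                                   ∎

  module _ {n d : ℕ} (b : Fin (suc d) → Vect n) where

    LinIndep-tail : LinIndep b → LinIndep (b ∘ suc)
    LinIndep-tail indep c tail≡0 i =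
      indep (0# Vector.∷ c) (trans (cong₂ _⊕_ (⊙-zeroˡ (b zero)) tail≡0) (⊕-identityˡ zeroV)) (suc i)

    LinIndep-head∉ : LinIndep b → ¬ InSpan (b ∘ suc) (b zero)
    LinIndep-head∉ indep (c , tail≡head) = -1≢0 (indep ((- 1#) Vector.∷ c) combination≡0 zero)
      where
      combination≡0 : ((- 1#) ⊙ b zero) ⊕ lincomb c (b ∘ suc) ≡ zeroV
      combination≡0 = trans (cong (((- 1#) ⊙ b zero) ⊕_) tail≡head)
                            (trans (⊕-comm _ (b zero)) (⊕-inverseʳ (b zero)))

    LinIndep-cons : LinIndep (b ∘ suc) → ¬ InSpan (b ∘ suc) (b zero) → LinIndep b
    LinIndep-cons tail-indep head∉ c combination≡0 with c zero ≟ 0#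
    ... | yes c₀≡0 = λ { zero → c₀≡0 ; (suc i) → tail-indep (c ∘ suc) tail≡0 i }
      where
      tail≡0 : lincomb (c ∘ suc) (b ∘ suc) ≡ zeroV
      tail≡0 = begin
        lincomb (c ∘ suc) (b ∘ suc)                      ≡⟨ ⊕-identityˡ _ ⟨
        zeroV ⊕ lincomb (c ∘ suc) (b ∘ suc)
          ≡⟨ cong (_⊕ lincomb (c ∘ suc) (b ∘ suc)) (trans (sym (⊙-zeroˡ (b zero))) (cong (_⊙ b zero) (sym c₀≡0))) ⟩
        (c zero ⊙ b zero) ⊕ lincomb (c ∘ suc) (b ∘ suc)  ≡⟨ combination≡0 ⟩
        zeroV                                            ∎
        where open ≡-Reasoning
    ... | no c₀≢0 = ⊥-elim (head∉ ((λ i → (c zero ⁻¹) * ((- 1#) * c (suc i))) , head-expansion))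
      where
      open ≡-Reasoning
      L = lincomb (c ∘ suc) (b ∘ suc)
      head-expansion : lincomb (λ i → (c zero ⁻¹) * ((- 1#) * c (suc i))) (b ∘ suc) ≡ b zero
      head-expansion = begin
        lincomb (λ i → (c zero ⁻¹) * ((- 1#) * c (suc i))) (b ∘ suc)
          ≡⟨ lincomb-* (c zero ⁻¹) _ (b ∘ suc) ⟩
        (c zero ⁻¹) ⊙ lincomb (λ i → (- 1#) * c (suc i)) (b ∘ suc)
          ≡⟨ cong ((c zero ⁻¹) ⊙_) (lincomb-* (- 1#) (c ∘ suc) (b ∘ suc)) ⟩
        (c zero ⁻¹) ⊙ ((- 1#) ⊙ L)
          ≡⟨ cong ((c zero ⁻¹) ⊙_) (⊕-inverseˡ-unique _ L combination≡0) ⟨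
        (c zero ⁻¹) ⊙ (c zero ⊙ b zero)
          ≡⟨ ⊙-⁻¹-cancel c₀≢0 (b zero) ⟩
        b zero ∎

  Vect-finite : ∀ n → Finite (Vect n)
  Vect-finite = Vec-finite Carrier-finite

  size-Vect-finite : ∀ n → size (Vect-finite n) ≡ q ^ n
  size-Vect-finite n =
    trans (size-Vec-finite Carrier-finite n)
          (cong (_^ n) (trans (size-↔-finite (↔-sym card) (Fin-finite q)) (size-Fin-finite q)))

  _≟ᵥ_ : ∀ {n} → DecidableEquality (Vect n)
  _≟ᵥ_ {n} = Finite._≟_ (Vect-finite n)

  allVect : ∀ n → List (Vect n)
  allVect n = elements (Vect-finite n)

  module _ {n d : ℕ} (b : Fin d → Vect n) where

    private
      combinations : List (Vect n)
      combinations = List.map (λ c → lincomb (Vec.lookup c) b) (allVect d)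

      InSpan⇔∈combinations : ∀ v → InSpan b v ⇔ v ∈ combinations
      InSpan⇔∈combinations v = mk⇔
        (λ (c , c≡v) → subst (_∈ combinations) (trans (lincomb-cong (Vec.lookup∘tabulate c) (λ _ → refl)) c≡v)
                             (∈-map⁺ _ (complete (Vect-finite d) (Vec.tabulate c))))
        (λ v∈ → let c , _ , v≡c = ∈-map⁻ _ v∈ in Vec.lookup c , sym v≡c)

    InSpan? : Decidable (InSpan b)
    InSpan? v = map′ (Equivalence.from (InSpan⇔∈combinations v)) (Equivalence.to (InSpan⇔∈combinations v))
                     (v ∈? combinations)
      where open import Data.List.Membership.DecPropositional _≟ᵥ_ using (_∈?_)

    count-InSpan : LinIndep b → count InSpan? (allVect n) ≡ q ^ d
    count-InSpan indep = begin
      count InSpan? (allVect n)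
        ≡⟨ Finite.count-enumerated (Vect-finite n) InSpan? (Unique.map⁺ coefficients-injective (unique (Vect-finite d)))
                                   InSpan⇔∈combinations ⟩
      length combinations        ≡⟨ List.length-map _ (allVect d) ⟩
      size (Vect-finite d)       ≡⟨ size-Vect-finite d ⟩
      q ^ d                      ∎
      where
      open ≡-Reasoning
      coefficients-injective : ∀ {c c′} → lincomb (Vec.lookup c) b ≡ lincomb (Vec.lookup c′) b → c ≡ c′
      coefficients-injective same = Pointwise-≡⇒≡ (ext (LinIndep-injective b indep _ _ same))

  InSpan-cong : ∀ {n d} (b b′ : Fin d → Vect n) → (∀ i → b i ≡ b′ i) → ∀ {x} → InSpan b x → InSpan b′ x
  InSpan-cong b b′ b≗b′ (c , refl) = c , lincomb-cong (λ _ → refl) (sym ∘ b≗b′)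

  InSpan-⊆ : ∀ {n d e} (b : Fin d → Vect n) (u : Fin e → Vect n) → (∀ i → InSpan b (u i)) → ∀ v → InSpan u v → InSpan b v
  InSpan-⊆ b u u⊆b v (c , refl) = InSpan-lincomb b u c u⊆b

  HasDim⇒Decidable : ∀ {n d} {U : Space n} → HasDim U d → Decidable U
  HasDim⇒Decidable (b , _ , U⇔b) v = map′ (Equivalence.from (U⇔b v)) (Equivalence.to (U⇔b v)) (InSpan? b v)

  count-HasDim : ∀ {n d} {U : Space n} (U? : Decidable U) → HasDim U d → count U? (allVect n) ≡ q ^ d
  count-HasDim {n} U? (b , b-indep , U⇔b) =
    trans (count-cong U? (InSpan? b) (allVect n) (λ w → Equivalence.to (U⇔b w)) (λ w → Equivalence.from (U⇔b w)))
          (count-InSpan b b-indep)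

  HasDim-unique : ∀ {n d d′} {U : Space n} → HasDim U d → HasDim U d′ → d ≡ d′
  HasDim-unique U-dim U-dim′ =
    ^-injective 1<q (trans (sym (count-HasDim (HasDim⇒Decidable U-dim) U-dim)) (count-HasDim (HasDim⇒Decidable U-dim) U-dim′))

  module _ {n e j} {U : Space n} (U? : Decidable U) (count-U : count U? (allVect n) ≡ q ^ e)
           (u : Fin j → Vect n) (u-indep : LinIndep u) (u⊆U : ∀ w → InSpan u w → U w) where

    count-∖-InSpan : count (λ w → U? w ×-dec ¬? (InSpan? u w)) (allVect n) ≡ q ^ e ∸ q ^ j
    count-∖-InSpan = begin
      count U∖u? (allVect n)                                        ≡⟨ ℕ.m+n∸m≡n (count (InSpan? u) (allVect n)) _ ⟨
      count (InSpan? u) (allVect n) ℕ.+ count U∖u? (allVect n) ∸ count (InSpan? u) (allVect n)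
        ≡⟨ cong₂ _∸_ (sym (count-split U? (InSpan? u) (allVect n) u⊆U)) (count-InSpan u u-indep) ⟩
      count U? (allVect n) ∸ q ^ j                                  ≡⟨ cong (_∸ q ^ j) count-U ⟩
      q ^ e ∸ q ^ j                                                 ∎
      where
      open ≡-Reasoning
      U∖u? = λ w → U? w ×-dec ¬? (InSpan? u w)

    ∖-InSpan-nonempty : j < e → ∃ λ x → U x × ¬ InSpan u x
    ∖-InSpan-nonempty j<e =
      let x , _ , x∈U∖u = count-witness _ (allVect n) (subst (0 <_) (sym count-∖-InSpan) (ℕ.m<n⇒0<n∸m (ℕ.^-monoʳ-< q 1<q j<e)))
      in x , x∈U∖u

    ⊆-InSpan-equal-dim : j ≡ e → ∀ {w} → U w → InSpan u w
    ⊆-InSpan-equal-dim refl {w} w∈U with InSpan? u w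
    ... | yes w∈u = w∈u
    ... | no w∉u  = ⊥-elim (ℕ.<-irrefl (sym (trans count-∖-InSpan (ℕ.n∸n≡0 (q ^ e))))
                                        (count-pos _ (complete (Vect-finite n) w) (w∈U , w∉u)))

  extend-LinIndep : ∀ {n e j} (b : Fin e → Vect n) → LinIndep b → (t : Vec (Vect n) j) → LinIndep (Vec.lookup t) →
                    (∀ i → InSpan b (Vec.lookup t i)) → ∀ r → r ℕ.+ j ≤ e →
                    Σ (Vec (Vect n) r) λ u → LinIndep (Vec.lookup (u Vec.++ t)) × (∀ i → InSpan b (Vec.lookup (u Vec.++ t) i))
  extend-LinIndep b b-indep t t-indep t⊆b zero    _   = [] , t-indep , t⊆b
  extend-LinIndep b b-indep t t-indep t⊆b (suc r) r+j<e with extend-LinIndep b b-indep t t-indep t⊆b r (ℕ.<⇒≤ r+j<e)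
  ... | u , u-indep , u⊆b with ∖-InSpan-nonempty (InSpan? b) (count-InSpan b b-indep) (Vec.lookup (u Vec.++ t)) u-indep (InSpan-⊆ b _ u⊆b) r+j<e
  ... | x , x∈b , x∉u = x ∷ u , LinIndep-cons (Vec.lookup (x ∷ u Vec.++ t)) u-indep x∉u , λ { zero → x∈b ; (suc i) → u⊆b i }

  -- Deleting the last coordinate

  init-⊕ : ∀ {v} (x y : Vect (suc v)) → init (x ⊕ y) ≡ init x ⊕ init y
  init-⊕ {zero}  (a ∷ []) (b ∷ []) = refl
  init-⊕ {suc v} (a ∷ x)  (b ∷ y)  = cong ((a + b) ∷_) (init-⊕ x y)

  last-⊕ : ∀ {v} (x y : Vect (suc v)) → last (x ⊕ y) ≡ last x + last y
  last-⊕ {zero}  (a ∷ []) (b ∷ []) = refl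
  last-⊕ {suc v} (a ∷ x)  (b ∷ y)  = last-⊕ x y

  init-⊙ : ∀ {v} c (x : Vect (suc v)) → init (c ⊙ x) ≡ c ⊙ init x
  init-⊙ {zero}  c (a ∷ []) = refl
  init-⊙ {suc v} c (a ∷ x)  = cong ((c * a) ∷_) (init-⊙ c x)

  last-⊙ : ∀ {v} c (x : Vect (suc v)) → last (c ⊙ x) ≡ c * last x
  last-⊙ {zero}  c (a ∷ []) = refl
  last-⊙ {suc v} c (a ∷ x)  = last-⊙ c x

  init-zeroV : ∀ {v} → init (zeroV {suc v}) ≡ zeroV
  init-zeroV {zero}  = refl
  init-zeroV {suc v} = cong (0# ∷_) (init-zeroV {v})

  last-zeroV : ∀ {v} → last (zeroV {suc v}) ≡ 0#
  last-zeroV {zero}  = refl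
  last-zeroV {suc v} = last-zeroV {v}

  init-last-injective : ∀ {v} (x y : Vect (suc v)) → init x ≡ init y → last x ≡ last y → x ≡ y
  init-last-injective x y init≡ last≡ = trans (init∷ʳlast x) (trans (cong₂ _∷ʳ_ init≡ last≡) (sym (init∷ʳlast y)))
    where
    init∷ʳlast : ∀ (x : Vect (suc _)) → x ≡ init x ∷ʳ last x
    init∷ʳlast x = proj₂ (proj₂ (Vec.initLast x))

  dropLast≡init : ∀ {v} (x : Vect (suc v)) → dropLast x ≡ init x
  dropLast≡init (_ ∷ _) = refl

  init-lincomb : ∀ {v d} (c : Fin d → Carrier) (b : Fin d → Vect (suc v)) → init (lincomb c b) ≡ lincomb c (init ∘ b)
  init-lincomb {v} {zero}  c b = init-zeroV {v}
  init-lincomb {v} {suc d} c b =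
    trans (init-⊕ _ _) (cong₂ _⊕_ (init-⊙ (c zero) (b zero)) (init-lincomb (c ∘ suc) (b ∘ suc)))

  init-lincomb-zero : ∀ {v d} (c : Fin d → Carrier) (b : Fin d → Vect (suc v)) →
                      (∀ i → init (b i) ≡ zeroV) → init (lincomb c b) ≡ zeroV
  init-lincomb-zero c b init-b≡0 = trans (init-lincomb c b) (trans (lincomb-cong (λ _ → refl) init-b≡0) (lincomb-zeroʳ c))

  last-lincomb-zero : ∀ {v d} (c : Fin d → Carrier) (b : Fin d → Vect (suc v)) →
                      (∀ i → last (b i) ≡ 0#) → last (lincomb c b) ≡ 0#
  last-lincomb-zero {v} {zero}  c b _         = last-zeroV {v}
  last-lincomb-zero {v} {suc d} c b last-b≡0 = begin
    last ((c zero ⊙ b zero) ⊕ lincomb (c ∘ suc) (b ∘ suc))         ≡⟨ last-⊕ (c zero ⊙ b zero) _ ⟩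
    last (c zero ⊙ b zero) + last (lincomb (c ∘ suc) (b ∘ suc))
      ≡⟨ cong₂ _+_ (last-⊙ (c zero) (b zero)) (last-lincomb-zero (c ∘ suc) (b ∘ suc) (last-b≡0 ∘ suc)) ⟩
    (c zero * last (b zero)) + 0#                                  ≡⟨ cong (λ a → (c zero * a) + 0#) (last-b≡0 zero) ⟩
    (c zero * 0#) + 0#                                             ≡⟨ trans (+-identityʳ _) (zeroʳ (c zero)) ⟩
    0#                                                             ∎
    where open ≡-Reasoning

  eₙ : ∀ {v} → Vect (suc v)
  eₙ = zeroV ∷ʳ 1#

  init-eₙ : ∀ {v} → init (eₙ {v}) ≡ zeroV
  init-eₙ {v} = Vec.init-∷ʳ 1# (zeroV {v})

  last-eₙ : ∀ {v} → last (eₙ {v}) ≡ 1#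
  last-eₙ {v} = Vec.last-∷ʳ 1# (zeroV {v})

  eₙ≢zeroV : ∀ {v} → eₙ {v} ≢ zeroV
  eₙ≢zeroV {v} eₙ≡0 = 0≢1 (trans (sym (last-zeroV {v})) (trans (cong last (sym eₙ≡0)) (last-eₙ {v})))

  init-⊙eₙ : ∀ {v} a → init (a ⊙ eₙ {v}) ≡ zeroV
  init-⊙eₙ {v} a = trans (init-⊙ a (eₙ {v})) (trans (cong (a ⊙_) (init-eₙ {v})) (⊙-zeroʳ a))

  last-⊙eₙ : ∀ {v} a → last (a ⊙ eₙ {v}) ≡ a
  last-⊙eₙ {v} a = trans (last-⊙ a (eₙ {v})) (trans (cong (a *_) (last-eₙ {v})) (*-identityʳ a))

  same-init⇒differ-by-eₙ : ∀ {v} (x y : Vect (suc v)) → init x ≡ init y → y ≡ x ⊕ ((last y + (- last x)) ⊙ eₙ)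
  same-init⇒differ-by-eₙ {v} x y init≡ = init-last-injective _ _
    (sym (begin
      init (x ⊕ (a ⊙ eₙ {v}))      ≡⟨ init-⊕ x (a ⊙ eₙ {v}) ⟩
      init x ⊕ init (a ⊙ eₙ {v})   ≡⟨ cong₂ _⊕_ init≡ (init-⊙eₙ {v} a) ⟩
      init y ⊕ zeroV           ≡⟨ ⊕-identityʳ (init y) ⟩
      init y                   ∎))
    (sym (begin
      last (x ⊕ (a ⊙ eₙ {v}))              ≡⟨ last-⊕ x (a ⊙ eₙ {v}) ⟩
      last x + last (a ⊙ eₙ {v})           ≡⟨ cong (last x +_) (last-⊙eₙ {v} a) ⟩
      last x + (last y + (- last x))   ≡⟨ +-comm (last x) a ⟩
      (last y + (- last x)) + last x   ≡⟨ +-assoc (last y) (- last x) (last x) ⟩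
      last y + ((- last x) + last x)   ≡⟨ cong (last y +_) (-‿inverseˡ (last x)) ⟩
      last y + 0#                      ≡⟨ +-identityʳ (last y) ⟩
      last y                           ∎))
    where
    open ≡-Reasoning
    a = last y + (- last x)

  same-init⇒difference≡⊙eₙ : ∀ {v} (x y : Vect (suc v)) → init x ≡ init y →
                          x ⊕ ((- 1#) ⊙ y) ≡ (last x + (- last y)) ⊙ eₙ
  same-init⇒difference≡⊙eₙ {v} x y init≡ = init-last-injective _ _
    (begin
      init (x ⊕ ((- 1#) ⊙ y))      ≡⟨ init-⊕ x _ ⟩
      init x ⊕ init ((- 1#) ⊙ y)   ≡⟨ cong₂ _⊕_ init≡ (init-⊙ (- 1#) y) ⟩
      init y ⊕ ((- 1#) ⊙ init y)   ≡⟨ ⊕-inverseʳ (init y) ⟩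
      zeroV                        ≡⟨ init-⊙eₙ {v} _ ⟨
      init ((last x + (- last y)) ⊙ eₙ {v}) ∎)
    (begin
      last (x ⊕ ((- 1#) ⊙ y))      ≡⟨ last-⊕ x _ ⟩
      last x + last ((- 1#) ⊙ y)   ≡⟨ cong (last x +_) (trans (last-⊙ (- 1#) y) (-1*x≈-x (last y))) ⟩
      last x + (- last y)          ≡⟨ last-⊙eₙ {v} _ ⟨
      last ((last x + (- last y)) ⊙ eₙ {v}) ∎)
    where open ≡-Reasoning

  init-lincomb-∷ʳ : ∀ {v d} (c : Fin d → Carrier) (w : Fin d → Vect v) (a : Fin d → Carrier) →
                    init (lincomb c (λ i → w i ∷ʳ a i)) ≡ lincomb c w
  init-lincomb-∷ʳ c w a = trans (init-lincomb c _) (lincomb-cong (λ _ → refl) (λ i → Vec.init-∷ʳ (a i) (w i)))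

  LinIndep-∷ʳ : ∀ {v d} (w : Fin d → Vect v) (a : Fin d → Carrier) → LinIndep w → LinIndep (λ i → w i ∷ʳ a i)
  LinIndep-∷ʳ w a w-indep c combination≡0 =
    w-indep c (trans (sym (init-lincomb-∷ʳ c w a)) (trans (cong init combination≡0) init-zeroV))

  LinIndep-eₙ∷ : ∀ {v d} (w : Fin d → Vect v) → LinIndep w → LinIndep (eₙ Vector.∷ (λ i → w i ∷ʳ 0#))
  LinIndep-eₙ∷ {v} w w-indep = LinIndep-cons (eₙ Vector.∷ (λ i → w i ∷ʳ 0#)) (LinIndep-∷ʳ w (λ _ → 0#) w-indep) eₙ∉
    where
    eₙ∉ : ¬ InSpan (λ i → w i ∷ʳ 0#) eₙ
    eₙ∉ (c , c≡eₙ) = 0≢1 (begin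
      0#                                  ≡⟨ last-lincomb-zero c (λ i → w i ∷ʳ 0#) (λ i → Vec.last-∷ʳ 0# (w i)) ⟨
      last (lincomb c (λ i → w i ∷ʳ 0#))  ≡⟨ cong last c≡eₙ ⟩
      last (eₙ {v})                       ≡⟨ last-eₙ {v} ⟩
      1#                                  ∎)
      where open ≡-Reasoning

  init-InSpan-eₙ∷ : ∀ {v e} (w : Fin e → Vect v) {x} → InSpan (eₙ Vector.∷ (λ l → w l ∷ʳ 0#)) x → InSpan w (init x)
  init-InSpan-eₙ∷ {v} w (c , refl) = c ∘ suc , sym (begin
    init ((c zero ⊙ eₙ) ⊕ lincomb (c ∘ suc) (λ l → w l ∷ʳ 0#))
      ≡⟨ init-⊕ _ _ ⟩
    init (c zero ⊙ eₙ) ⊕ init (lincomb (c ∘ suc) (λ l → w l ∷ʳ 0#))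
      ≡⟨ cong₂ _⊕_ (init-⊙eₙ {v} (c zero)) (init-lincomb-∷ʳ (c ∘ suc) w (λ _ → 0#)) ⟩
    zeroV ⊕ lincomb (c ∘ suc) w
      ≡⟨ ⊕-identityˡ _ ⟩
    lincomb (c ∘ suc) w ∎)
    where open ≡-Reasoning

  module Subspace {n d} {U : Space n} (U-dim : HasDim U d) where

    basis : Fin d → Vect n
    basis = proj₁ U-dim

    basis-indep : LinIndep basis
    basis-indep = proj₁ (proj₂ U-dim)

    ∈⇒InSpan : ∀ {x} → U x → InSpan basis x
    ∈⇒InSpan {x} = Equivalence.to (proj₂ (proj₂ U-dim) x)

    InSpan⇒∈ : ∀ {x} → InSpan basis x → U x
    InSpan⇒∈ {x} = Equivalence.from (proj₂ (proj₂ U-dim) x)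

    ∈-zeroV : U zeroV
    ∈-zeroV = InSpan⇒∈ (InSpan-zero basis)

    ∈-⊕ : ∀ {x y} → U x → U y → U (x ⊕ y)
    ∈-⊕ x∈U y∈U = InSpan⇒∈ (InSpan-⊕ basis (∈⇒InSpan x∈U) (∈⇒InSpan y∈U))

    ∈-⊙ : ∀ a {x} → U x → U (a ⊙ x)
    ∈-⊙ a x∈U = InSpan⇒∈ (InSpan-⊙ basis a (∈⇒InSpan x∈U))

    ∈-InSpan : ∀ {e} (u : Fin e → Vect n) → (∀ i → U (u i)) → ∀ {x} → InSpan u x → U x
    ∈-InSpan u u⊆U {x} x∈u = InSpan⇒∈ (InSpan-⊆ basis u (∈⇒InSpan ∘ u⊆U) x x∈u)

    ∈? : Decidable U
    ∈? = HasDim⇒Decidable U-dim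

  module Shortening {v d} {U : Space (suc v)} (U-dim : HasDim U d) where
    open Subspace U-dim

    shorten-⊇-init : ∀ {e} (u : Fin e → Vect (suc v)) → (∀ l → U (u l)) → ∀ {x} → InSpan (init ∘ u) x → shorten U x
    shorten-⊇-init u u⊆U (c , refl) = lincomb c u , ∈-InSpan u u⊆U (c , refl) , trans (dropLast≡init _) (init-lincomb c u)

    shorten⇔InSpan-init : ∀ w → shorten U w ⇔ InSpan (init ∘ basis) w
    shorten⇔InSpan-init w = mk⇔ to (shorten-⊇-init basis (InSpan⇒∈ ∘ InSpan-member basis))
      where
      to : shorten U w → InSpan (init ∘ basis) w
      to (x , x∈U , refl) with ∈⇒InSpan x∈U
      ... | c , refl = c , sym (trans (dropLast≡init _) (init-lincomb c basis))

    shorten? : Decidable (shorten U)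
    shorten? w = map′ (Equivalence.from (shorten⇔InSpan-init w)) (Equivalence.to (shorten⇔InSpan-init w))
                      (InSpan? (init ∘ basis) w)

    shorten-∈-InSpan : ∀ {e} (u : Fin e → Vect v) → (∀ i → shorten U (u i)) → ∀ {w} → InSpan u w → shorten U w
    shorten-∈-InSpan u u⊆U′ {w} w∈u = Equivalence.from (shorten⇔InSpan-init w)
      (InSpan-⊆ (init ∘ basis) u (λ i → Equivalence.to (shorten⇔InSpan-init (u i)) (u⊆U′ i)) w w∈u)

    shorten-⊇-lifts : ∀ {e} (w : Fin e → Vect v) (a : Fin e → Carrier) → (∀ l → U (w l ∷ʳ a l)) →
                      ∀ {x} → InSpan w x → shorten U x
    shorten-⊇-lifts w a lifts⊆U = shorten-⊇-init _ lifts⊆U ∘ InSpan-cong w _ (λ l → sym (Vec.init-∷ʳ (a l) (w l)))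

    ∈-of-same-init : U eₙ → ∀ {x y} → U x → init x ≡ init y → U y
    ∈-of-same-init eₙ∈U {x} {y} x∈U init≡ =
      subst U (sym (same-init⇒differ-by-eₙ x y init≡)) (∈-⊕ x∈U (∈-⊙ _ eₙ∈U))

    lift-∈ : U eₙ → ∀ {w} → shorten U w → ∀ a → U (w ∷ʳ a)
    lift-∈ eₙ∈U {w} (x , x∈U , x′≡w) a =
      ∈-of-same-init eₙ∈U x∈U (trans (sym (dropLast≡init x)) (trans x′≡w (sym (Vec.init-∷ʳ a w))))

    eₙ∷lifts-⊆ : U eₙ → ∀ {e} (w : Fin e → Vect v) → (∀ l → shorten U (w l)) → ∀ p → U ((eₙ Vector.∷ (λ l → w l ∷ʳ 0#)) p)
    eₙ∷lifts-⊆ eₙ∈U w w⊆U′ zero    = eₙ∈U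
    eₙ∷lifts-⊆ eₙ∈U w w⊆U′ (suc l) = lift-∈ eₙ∈U (w⊆U′ l) 0#

    eₙ∈-of-same-init : ∀ {x y} → U x → U y → init x ≡ init y → last x ≢ last y → U eₙ
    eₙ∈-of-same-init {x} {y} x∈U y∈U init≡ last≢ =
      subst U (⊙-⁻¹-cancel a≢0 eₙ) (∈-⊙ (a ⁻¹) (subst U (same-init⇒difference≡⊙eₙ x y init≡) (∈-⊕ x∈U (∈-⊙ (- 1#) y∈U))))
      where
      a = last x + (- last y)
      a≢0 : a ≢ 0#
      a≢0 = last≢ ∘ x∙y⁻¹≈ε⇒x≈y (last x) (last y)

    shorten-HasDim-eₙ∉ : ¬ U eₙ → HasDim (shorten U) d
    shorten-HasDim-eₙ∉ eₙ∉U = init ∘ basis , init-basis-indep , shorten⇔InSpan-init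
      where
      init-basis-indep : LinIndep (init ∘ basis)
      init-basis-indep c init-combination≡0 = basis-indep c combination≡0
        where
        X = lincomb c basis
        init-X≡0 : init X ≡ init (zeroV {suc v})
        init-X≡0 = trans (init-lincomb c basis) (trans init-combination≡0 (sym init-zeroV))
        last-X≡0 : last X ≡ last (zeroV {suc v})
        last-X≡0 with last X ≟ last (zeroV {suc v})
        ... | yes ≡0 = ≡0
        ... | no ≢0  = ⊥-elim (eₙ∉U (eₙ∈-of-same-init (InSpan⇒∈ (c , refl)) ∈-zeroV init-X≡0 ≢0))
        combination≡0 : X ≡ zeroV
        combination≡0 = init-last-injective X zeroV init-X≡0 last-X≡0

  module _ {v r : ℕ} (u : Vec (Vect (suc v)) r) where
    private
      t : Vec (Vect (suc v)) 1
      t = eₙ ∷ []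

    init-InSpan-++eₙ : ∀ {x} → InSpan (Vec.lookup (u Vec.++ t)) x → InSpan (init ∘ Vec.lookup u) (init x)
    init-InSpan-++eₙ (c , refl) = c ∘ (Fin._↑ˡ 1) , sym (begin
      init (lincomb c (Vec.lookup (u Vec.++ t)))
        ≡⟨ cong init (lincomb-++ u t c) ⟩
      init (lincomb (c ∘ (Fin._↑ˡ 1)) (Vec.lookup u) ⊕ lincomb (c ∘ (r Fin.↑ʳ_)) (Vec.lookup t))
        ≡⟨ init-⊕ _ _ ⟩
      init (lincomb (c ∘ (Fin._↑ˡ 1)) (Vec.lookup u)) ⊕ init (lincomb (c ∘ (r Fin.↑ʳ_)) (Vec.lookup t))
        ≡⟨ cong₂ _⊕_ (init-lincomb _ (Vec.lookup u)) (init-lincomb-zero (c ∘ (r Fin.↑ʳ_)) (Vec.lookup t) λ { zero → init-eₙ }) ⟩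
      lincomb (c ∘ (Fin._↑ˡ 1)) (init ∘ Vec.lookup u) ⊕ zeroV
        ≡⟨ ⊕-identityʳ _ ⟩
      lincomb (c ∘ (Fin._↑ˡ 1)) (init ∘ Vec.lookup u) ∎)
      where open ≡-Reasoning

    LinIndep-init-++eₙ : LinIndep (Vec.lookup (u Vec.++ t)) → LinIndep (init ∘ Vec.lookup u)
    LinIndep-init-++eₙ indep c init-combination≡0 i =
      trans (sym (Vector.lookup-++ˡ c _ i)) (indep (c Vector.++ (λ _ → - a)) combination≡0 (i Fin.↑ˡ 1))
      where
      open ≡-Reasoning
      X = lincomb c (Vec.lookup u)
      a = last X
      X≡a⊙eₙ : X ≡ a ⊙ eₙ
      X≡a⊙eₙ = init-last-injective X (a ⊙ eₙ)
        (trans (init-lincomb c _) (trans init-combination≡0 (sym (init-⊙eₙ {v} a)))) (sym (last-⊙eₙ {v} a))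
      combination≡0 : lincomb (c Vector.++ (λ _ → - a)) (Vec.lookup (u Vec.++ t)) ≡ zeroV
      combination≡0 = begin
        lincomb (c Vector.++ (λ _ → - a)) (Vec.lookup (u Vec.++ t))
          ≡⟨ lincomb-++ u t _ ⟩
        lincomb (λ i → (c Vector.++ _) (i Fin.↑ˡ 1)) (Vec.lookup u) ⊕ (((c Vector.++ (λ _ → - a)) (r Fin.↑ʳ zero) ⊙ eₙ) ⊕ zeroV)
          ≡⟨ cong₂ _⊕_ (lincomb-cong (Vector.lookup-++ˡ c _) (λ _ → refl))
                       (trans (⊕-identityʳ _) (cong (_⊙ eₙ) (Vector.lookup-++ʳ c _ zero))) ⟩
        X ⊕ ((- a) ⊙ eₙ)               ≡⟨ cong (_⊕ ((- a) ⊙ eₙ)) X≡a⊙eₙ ⟩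
        (a ⊙ eₙ) ⊕ ((- a) ⊙ eₙ)        ≡⟨ ⊙-distribʳ a (- a) eₙ ⟨
        (a + (- a)) ⊙ eₙ               ≡⟨ cong (_⊙ eₙ) (-‿inverseʳ a) ⟩
        0# ⊙ eₙ                        ≡⟨ ⊙-zeroˡ eₙ ⟩
        zeroV                          ∎

  shorten-HasDim-eₙ∈ : ∀ {v d} {U : Space (suc v)} → HasDim U (suc d) → U eₙ → HasDim (shorten U) d
  shorten-HasDim-eₙ∈ {v} {d} {U} U-dim eₙ∈U =
    init ∘ Vec.lookup u , LinIndep-init-++eₙ u b-indep , λ w → mk⇔ (shorten⊆ w) (Shortening.shorten-⊇-init U-dim (Vec.lookup u) u⊆U)
    where
    open Subspace U-dim
    t : Vec (Vect (suc v)) 1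
    t = eₙ ∷ []
    t-indep : LinIndep (Vec.lookup t)
    t-indep = LinIndep-cons (Vec.lookup t) (λ _ _ ()) (λ (_ , 0≡eₙ) → eₙ≢zeroV (sym 0≡eₙ))
    extension = extend-LinIndep basis basis-indep t t-indep (λ { zero → ∈⇒InSpan eₙ∈U }) d (ℕ.≤-reflexive (ℕ.+-comm d 1))
    u = proj₁ extension
    b = Vec.lookup (u Vec.++ t)
    b-indep : LinIndep b
    b-indep = proj₁ (proj₂ extension)
    U⊆b : ∀ {x} → U x → InSpan b x
    U⊆b = ⊆-InSpan-equal-dim (InSpan? basis) (count-InSpan basis basis-indep) b b-indep
            (InSpan-⊆ basis b (proj₂ (proj₂ extension))) (ℕ.+-comm d 1) ∘ ∈⇒InSpan
    u⊆U : ∀ i → U (Vec.lookup u i)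
    u⊆U i = subst U (Vec.lookup-++ˡ u t i) (InSpan⇒∈ (proj₂ (proj₂ extension) (i Fin.↑ˡ 1)))
    shorten⊆ : ∀ w → shorten U w → InSpan (init ∘ Vec.lookup u) w
    shorten⊆ _ (x , x∈U , refl) = subst (InSpan _) (sym (dropLast≡init x)) (init-InSpan-++eₙ u (U⊆b x∈U))

  -- Counting independent tuples

  LinIndep? : ∀ {n j} (t : Vec (Vect n) j) → Dec (LinIndep (Vec.lookup t))
  LinIndep? []      = yes (λ _ _ ())
  LinIndep? (x ∷ t) with LinIndep? t | InSpan? (Vec.lookup t) x
  ... | no ¬t-indep | _        = no (¬t-indep ∘ LinIndep-tail (Vec.lookup (x ∷ t)))
  ... | yes _       | yes x∈t  = no (λ indep → LinIndep-head∉ (Vec.lookup (x ∷ t)) indep x∈t)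
  ... | yes t-indep | no x∉t   = yes (LinIndep-cons (Vec.lookup (x ∷ t)) t-indep x∉t)

  tuples : ∀ n j → List (Vec (Vect n) j)
  tuples n = elements ∘ Vec-finite (Vect-finite n)

  IndependentIn : ∀ {n j} → Space n → Vec (Vect n) j → Set
  IndependentIn U t = LinIndep (Vec.lookup t) × AllV U t

  module _ {n} {U : Space n} (U? : Decidable U) where

    IndepIn? : ∀ {j} (t : Vec (Vect n) j) → Dec (IndependentIn U t)
    IndepIn? t = LinIndep? t ×-dec VecAll.all? U? t

  module _ {n e} {U : Space n} (U? : Decidable U) (count-U : count U? (allVect n) ≡ q ^ e)
           (U-closed : ∀ {j} (t : Vec (Vect n) j) → AllV U t → ∀ w → InSpan (Vec.lookup t) w → U w) where

    ∑-IndepIn?-∷ : ∀ {j} (t : Vec (Vect n) j) →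
                   ∑[ x ← allVect n ] indicator (IndepIn? U? (x ∷ t)) ≡ indicator (IndepIn? U? t) ℕ.* (q ^ e ∸ q ^ j)
    ∑-IndepIn?-∷ {j} t = begin
      ∑[ x ← allVect n ] indicator (IndepIn? U? (x ∷ t))
        ≡⟨ ∑-cong (allVect n) (λ x → trans (indicator-cong cons⁻ cons⁺ (IndepIn? U? (x ∷ t)) (IndepIn? U? t ×-dec new? x))
                                          (indicator-× (IndepIn? U? t) (new? x))) ⟩
      ∑[ x ← allVect n ] (indicator (IndepIn? U? t) ℕ.* indicator (new? x))
        ≡⟨ ∑-*ˡ (allVect n) (indicator (IndepIn? U? t)) _ ⟩
      indicator (IndepIn? U? t) ℕ.* count new? (allVect n)
        ≡⟨ count-new (IndepIn? U? t) ⟩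
      indicator (IndepIn? U? t) ℕ.* (q ^ e ∸ q ^ j) ∎
      where
      open ≡-Reasoning
      new? = λ x → U? x ×-dec ¬? (InSpan? (Vec.lookup t) x)
      cons⁻ : ∀ {x} → IndependentIn U (x ∷ t) → IndependentIn U t × U x × ¬ InSpan (Vec.lookup t) x
      cons⁻ {x} (indep , x∈U ∷ t⊆U) =
        (LinIndep-tail (Vec.lookup (x ∷ t)) indep , t⊆U) , x∈U , LinIndep-head∉ (Vec.lookup (x ∷ t)) indep
      cons⁺ : ∀ {x} → IndependentIn U t × U x × ¬ InSpan (Vec.lookup t) x → IndependentIn U (x ∷ t)
      cons⁺ {x} ((t-indep , t⊆U) , x∈U , x∉t) = LinIndep-cons (Vec.lookup (x ∷ t)) t-indep x∉t , x∈U ∷ t⊆U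
      count-new : (t? : Dec (IndependentIn U t)) →
                  indicator t? ℕ.* count new? (allVect n) ≡ indicator t? ℕ.* (q ^ e ∸ q ^ j)
      count-new (no _)                = refl
      count-new (yes (t-indep , t⊆U)) =
        cong (1 ℕ.*_) (count-∖-InSpan {e = e} U? count-U (Vec.lookup t) t-indep (U-closed t t⊆U))

    count-IndepIn : ∀ j → count (IndepIn? U?) (tuples n j) ≡ indepTuples q e j
    count-IndepIn zero    = indicator-yes (IndepIn? U? []) ((λ _ _ ()) , [])
    count-IndepIn (suc j) = begin
      count (IndepIn? U?) (tuples n (suc j))
        ≡⟨ ∑-cartesianProductWith _∷_ (allVect n) (tuples n j) _ ⟩
      ∑[ x ← allVect n ] ∑[ t ← tuples n j ] indicator (IndepIn? U? (x ∷ t))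
        ≡⟨ ∑-comm (allVect n) (tuples n j) _ ⟩
      ∑[ t ← tuples n j ] ∑[ x ← allVect n ] indicator (IndepIn? U? (x ∷ t))
        ≡⟨ ∑-cong (tuples n j) (λ t → trans (∑-IndepIn?-∷ t) (ℕ.*-comm (indicator (IndepIn? U? t)) _)) ⟩
      ∑[ t ← tuples n j ] ((q ^ e ∸ q ^ j) ℕ.* indicator (IndepIn? U? t))
        ≡⟨ ∑-*ˡ (tuples n j) (q ^ e ∸ q ^ j) _ ⟩
      (q ^ e ∸ q ^ j) ℕ.* count (IndepIn? U?) (tuples n j)
        ≡⟨ cong ((q ^ e ∸ q ^ j) ℕ.*_) (count-IndepIn j) ⟩
      indepTuples q e (suc j) ∎
      where open ≡-Reasoning

  -- The derived design of an S_q(k-1, k, n), written with k = s + 2 and n = v + 1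

  module Steiner {s v m : ℕ} (B : Fin m → Space (suc v)) (steiner : IsSteiner (suc s) (suc (suc s)) (suc v) m B) where

    B-dim : ∀ i → HasDim (B i) (suc (suc s))
    B-dim = proj₁ steiner

    unique-block : ∀ (T : Space (suc v)) → HasDim T (suc s) → Σ (Fin m) λ i → T ⊆ B i × (∀ j → T ⊆ B j → j ≡ i)
    unique-block = proj₂ (proj₂ steiner)

    module Block (i : Fin m) = Subspace (B-dim i)
    module Block′ (i : Fin m) = Shortening (B-dim i)

    B′ : Fin m → Space v
    B′ i = shorten (B i)

    Derived : Fin m → Set
    Derived i = HasDim (B′ i) (suc s)

    eₙ∈⇒Derived : ∀ {i} → B i eₙ → Derived i
    eₙ∈⇒Derived {i} = shorten-HasDim-eₙ∈ (B-dim i)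

    Derived⇒eₙ∈ : ∀ {i} → Derived i → B i eₙ
    Derived⇒eₙ∈ {i} derived with Block.∈? i eₙ
    ... | yes eₙ∈Bᵢ = eₙ∈Bᵢ
    ... | no eₙ∉Bᵢ  = ⊥-elim (ℕ.1+n≢n (HasDim-unique (Block′.shorten-HasDim-eₙ∉ i eₙ∉Bᵢ) derived))

    block-through-eₙ : (T : Space v) → HasDim T s →
                       Σ (Fin m) λ i → B i eₙ × T ⊆ B′ i × (∀ j → B j eₙ → T ⊆ B′ j → j ≡ i)
    block-through-eₙ T (t , t-indep , T⇔t) = i , t′⊆Bᵢ eₙ (InSpan-member t′ zero) , T⊆B′ᵢ , only-block
      where
      t′ = eₙ Vector.∷ (λ l → t l ∷ʳ 0#)
      block = unique-block (InSpan t′) (t′ , LinIndep-eₙ∷ t t-indep , λ _ → mk⇔ id id)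
      i = proj₁ block
      t′⊆Bᵢ : InSpan t′ ⊆ B i
      t′⊆Bᵢ = proj₁ (proj₂ block)
      T⊆B′ᵢ : T ⊆ B′ i
      T⊆B′ᵢ w = Block′.shorten-⊇-lifts i t (λ _ → 0#) (λ l → t′⊆Bᵢ _ (InSpan-member t′ (suc l))) ∘ Equivalence.to (T⇔t w)
      only-block : ∀ j → B j eₙ → T ⊆ B′ j → j ≡ i
      only-block j eₙ∈Bⱼ T⊆B′ⱼ = proj₂ (proj₂ block) j λ _ → Block.∈-InSpan j t′
        (Block′.eₙ∷lifts-⊆ j eₙ∈Bⱼ t (λ l → T⊆B′ⱼ (t l) (Equivalence.from (T⇔t (t l)) (InSpan-member t l))))

    derived-steiner : ∀ (T : Space v) → HasDim T s →
                      Σ (Fin m) λ i → Derived i × T ⊆ B′ i × (∀ j → Derived j → T ⊆ B′ j → j ≡ i)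
    derived-steiner T T-dim =
      let i , eₙ∈Bᵢ , T⊆B′ᵢ , only-block = block-through-eₙ T T-dim
      in i , eₙ∈⇒Derived eₙ∈Bᵢ , T⊆B′ᵢ , λ j → only-block j ∘ Derived⇒eₙ∈

    B⊆B-of-B′⊆B′ : ∀ i j → B j eₙ → B′ i ⊆ B′ j → B i ⊆ B j
    B⊆B-of-B′⊆B′ i j eₙ∈Bⱼ B′ᵢ⊆B′ⱼ x x∈Bᵢ with B′ᵢ⊆B′ⱼ (init x) (x , x∈Bᵢ , dropLast≡init x)
    ... | y , y∈Bⱼ , y′≡x′ = Block′.∈-of-same-init j eₙ∈Bⱼ y∈Bⱼ (trans (sym (dropLast≡init y)) y′≡x′)

    derived-injective : ∀ i j → Derived i → Derived j → B′ i ≐ B′ j → i ≡ j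
    derived-injective i j derivedᵢ derivedⱼ B′ᵢ≐B′ⱼ = proj₁ (proj₂ steiner) i j λ x → mk⇔
      (B⊆B-of-B′⊆B′ i j (Derived⇒eₙ∈ derivedⱼ) (λ w → Equivalence.to (B′ᵢ≐B′ⱼ w)) x)
      (B⊆B-of-B′⊆B′ j i (Derived⇒eₙ∈ derivedᵢ) (λ w → Equivalence.from (B′ᵢ≐B′ⱼ w)) x)

    eₙ∈? : Decidable (λ i → B i eₙ)
    eₙ∈? i = Block.∈? i eₙ

    incident? : ∀ i (t : Vec (Vect v) s) → Dec (B i eₙ × IndependentIn (B′ i) t)
    incident? i t = eₙ∈? i ×-dec IndepIn? (Block′.shorten? i) t

    ∑-incident-blocks : ∀ t → ∑[ i ← allFin m ] indicator (incident? i t) ≡ indicator (LinIndep? t)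
    ∑-incident-blocks t = blocks-through t (LinIndep? t)
      where
      blocks-through : ∀ t (t-indep? : Dec (LinIndep (Vec.lookup t))) →
                       ∑[ i ← allFin m ] indicator (incident? i t) ≡ indicator t-indep?
      blocks-through t (no ¬t-indep) =
        count-none (λ i → incident? i t) {allFin m} (All.tabulate λ _ (_ , t-indep , _) → ¬t-indep t-indep)
      blocks-through t (yes t-indep) =
        let i , eₙ∈Bᵢ , span⊆B′ᵢ , only-block = block-through-eₙ (InSpan (Vec.lookup t)) (Vec.lookup t , t-indep , λ _ → mk⇔ id id)
        in Finite.count-enumerated (Fin-finite m) (λ i → incident? i t) ([] ∷ []) λ j → mk⇔
          (λ (eₙ∈Bⱼ , _ , t⊆B′ⱼ) → Any.here (only-block j eₙ∈Bⱼ λ w → Block′.shorten-∈-InSpan j (Vec.lookup t) (VecAll.lookup⁺ t⊆B′ⱼ)))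
          (λ { (Any.here refl) → eₙ∈Bᵢ , t-indep , VecAll.lookup⁻ (λ l → span⊆B′ᵢ _ (InSpan-member (Vec.lookup t) l)) })

    ∑-incident-tuples : ∀ i → ∑[ t ← tuples v s ] indicator (incident? i t) ≡ indicator (eₙ∈? i) ℕ.* indepTuples q (suc s) s
    ∑-incident-tuples i =
      trans (∑-cong (tuples v s) (λ t → indicator-× (eₙ∈? i) (IndepIn? (Block′.shorten? i) t)))
            (trans (∑-*ˡ (tuples v s) (indicator (eₙ∈? i)) _) (count-in-block (eₙ∈? i)))
      where
      count-in-block : (eₙ∈Bᵢ? : Dec (B i eₙ)) →
        indicator eₙ∈Bᵢ? ℕ.* count (IndepIn? (Block′.shorten? i)) (tuples v s) ≡ indicator eₙ∈Bᵢ? ℕ.* indepTuples q (suc s) s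
      count-in-block (no _)      = refl
      count-in-block (yes eₙ∈Bᵢ) = cong (1 ℕ.*_) (count-IndepIn (Block′.shorten? i) (count-HasDim _ (eₙ∈⇒Derived eₙ∈Bᵢ))
        (λ t t⊆B′ᵢ w → Block′.shorten-∈-InSpan i (Vec.lookup t) (VecAll.lookup⁺ t⊆B′ᵢ)) s)

    count-eₙ∈-blocks : count eₙ∈? (allFin m) ℕ.* indepTuples q (suc s) s ≡ indepTuples q v s
    count-eₙ∈-blocks = begin
      count eₙ∈? (allFin m) ℕ.* P
        ≡⟨ ℕ.*-comm _ P ⟩
      P ℕ.* count eₙ∈? (allFin m)
        ≡⟨ ∑-*ˡ (allFin m) P _ ⟨
      ∑[ i ← allFin m ] (P ℕ.* indicator (eₙ∈? i))
        ≡⟨ ∑-cong (allFin m) (λ i → trans (ℕ.*-comm P _) (sym (∑-incident-tuples i))) ⟩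
      ∑[ i ← allFin m ] ∑[ t ← tuples v s ] indicator (incident? i t)
        ≡⟨ ∑-comm (allFin m) (tuples v s) _ ⟩
      ∑[ t ← tuples v s ] ∑[ i ← allFin m ] indicator (incident? i t)
        ≡⟨ ∑-cong (tuples v s) ∑-incident-blocks ⟩
      count LinIndep? (tuples v s)
        ≡⟨ count-cong LinIndep? (IndepIn? everything?) (tuples v s) (λ t t-indep → t-indep , VecAll.lookup⁻ _) (λ _ → proj₁) ⟩
      count (IndepIn? everything?) (tuples v s)
        ≡⟨ count-IndepIn everything? (trans (∑-one (allVect v)) (size-Vect-finite v)) (λ _ _ _ _ → tt) s ⟩
      indepTuples q v s ∎
      where
      open ≡-Reasoning
      P = indepTuples q (suc s) s
      everything? : Decidable {A = Vect v} (λ _ → ⊤)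
      everything? _ = yes tt

    derived-count : Σ ℕ λ N → N ℕ.* gauss q (suc s) s ≡ gauss q v s × ExactlyN Derived N
    derived-count = length eₙ∈-blocks ,
      gauss-quotient 1<q {length eₙ∈-blocks} {suc s} {v} {s}
        (trans (cong (ℕ._* indepTuples q (suc s) s) (length-filter eₙ∈? (allFin m))) count-eₙ∈-blocks) ,
      exactlyN-fromList (Unique.filter⁺ eₙ∈? (Unique.allFin⁺ m)) λ i → mk⇔
        (∈-filter⁺ eₙ∈? (∈-allFin i) ∘ Derived⇒eₙ∈) (eₙ∈⇒Derived ∘ proj₂ ∘ ∈-filter⁻ eₙ∈? {xs = allFin m})
      where
      eₙ∈-blocks = filter eₙ∈? (allFin m)

    module NonDerived {W : Space v} (W-dim : HasDim W (suc s)) (W-new : ∀ i → Derived i → ¬ (W ≐ B′ i)) where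
      open Subspace W-dim using () renaming (basis to w; basis-indep to w-indep; ∈⇒InSpan to W⇒InSpan; InSpan⇒∈ to InSpan⇒W)

      lifted : Vec Carrier (suc s) → Fin (suc s) → Vect (suc v)
      lifted f l = w l ∷ʳ Vec.lookup f l

      lifted-block : ∀ f → Σ (Fin m) λ i → InSpan (lifted f) ⊆ B i × (∀ j → InSpan (lifted f) ⊆ B j → j ≡ i)
      lifted-block f = unique-block (InSpan (lifted f)) (lifted f , LinIndep-∷ʳ w (Vec.lookup f) w-indep , λ _ → mk⇔ id id)

      block-of : Vec Carrier (suc s) → Fin m
      block-of f = proj₁ (lifted-block f)

      lifted⊆block : ∀ f l → B (block-of f) (lifted f l)
      lifted⊆block f l = proj₁ (proj₂ (lifted-block f)) _ (InSpan-member (lifted f) l)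

      W⊆B′ : ∀ f → W ⊆ B′ (block-of f)
      W⊆B′ f x = Block′.shorten-⊇-lifts (block-of f) w (Vec.lookup f) (lifted⊆block f) ∘ W⇒InSpan

      eₙ∉block : ∀ f → ¬ B (block-of f) eₙ
      eₙ∉block f eₙ∈Bᵢ = W-new i (eₙ∈⇒Derived eₙ∈Bᵢ) (λ x → mk⇔ (W⊆B′ f x) (B′ᵢ⊆W x))
        where
        i = block-of f
        w′ = eₙ Vector.∷ (λ l → w l ∷ʳ 0#)
        w′⊆Bᵢ = Block′.eₙ∷lifts-⊆ i eₙ∈Bᵢ w (λ l → W⊆B′ f (w l) (InSpan⇒W (InSpan-member w l)))
        Bᵢ⊆w′ : ∀ {x} → B i x → InSpan w′ x
        Bᵢ⊆w′ = ⊆-InSpan-equal-dim (Block.∈? i) (count-HasDim _ (B-dim i)) w′ (LinIndep-eₙ∷ w w-indep)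
                                   (λ _ → Block.∈-InSpan i w′ w′⊆Bᵢ) refl
        B′ᵢ⊆W : B′ i ⊆ W
        B′ᵢ⊆W _ (y , y∈Bᵢ , refl) = InSpan⇒W (subst (InSpan w) (sym (dropLast≡init y)) (init-InSpan-eₙ∷ w (Bᵢ⊆w′ y∈Bᵢ)))

      block-of-injective : ∀ {f g} → block-of f ≡ block-of g → f ≡ g
      block-of-injective {f} {g} same-block = Pointwise-≡⇒≡ (ext agree)
        where
        agree : ∀ l → Vec.lookup f l ≡ Vec.lookup g l
        agree l with Vec.lookup f l ≟ Vec.lookup g l
        ... | yes fₗ≡gₗ = fₗ≡gₗ
        ... | no fₗ≢gₗ = ⊥-elim (eₙ∉block f (Block′.eₙ∈-of-same-init (block-of f)
              (lifted⊆block f l) (subst (λ i → B i (lifted g l)) (sym same-block) (lifted⊆block g l))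
              (trans (Vec.init-∷ʳ _ (w l)) (sym (Vec.init-∷ʳ _ (w l))))
              (λ lasts≡ → fₗ≢gₗ (trans (sym (Vec.last-∷ʳ _ (w l))) (trans lasts≡ (Vec.last-∷ʳ _ (w l)))))))

      Counted : Fin m → Set
      Counted i = HasDim (B′ i) (suc (suc s)) × W ⊆ B′ i

      block-of-counted : ∀ f → Counted (block-of f)
      block-of-counted f = Block′.shorten-HasDim-eₙ∉ (block-of f) (eₙ∉block f) , W⊆B′ f

      counted⇒block-of : ∀ i → Counted i → Σ (Vec Carrier (suc s)) λ f → block-of f ≡ i
      counted⇒block-of i (_ , W⊆B′ᵢ) = f , sym (proj₂ (proj₂ (lifted-block f)) i λ _ → Block.∈-InSpan i (lifted f) lifted⊆Bᵢ)
        where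
        preimage : ∀ l → B′ i (w l)
        preimage l = W⊆B′ᵢ (w l) (InSpan⇒W (InSpan-member w l))
        f = Vec.tabulate (λ l → last (proj₁ (preimage l)))
        lifted⊆Bᵢ : ∀ l → B i (lifted f l)
        lifted⊆Bᵢ l = let x , x∈Bᵢ , x′≡wₗ = preimage l in subst (B i)
          (init-last-injective x (lifted f l)
            (trans (sym (dropLast≡init x)) (trans x′≡wₗ (sym (Vec.init-∷ʳ _ (w l)))))
            (sym (trans (Vec.last-∷ʳ _ (w l)) (Vec.lookup∘tabulate (λ l → last (proj₁ (preimage l))) l))))
          x∈Bᵢ

      exactly-q^[s+1] : ExactlyN Counted (q ^ suc s)
      exactly-q^[s+1] = subst (ExactlyN Counted) (trans (List.length-map block-of (allVect (suc s))) (size-Vect-finite (suc s)))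
        (exactlyN-fromList (Unique.map⁺ block-of-injective (unique (Vect-finite (suc s)))) λ i → mk⇔
          (λ counted → let f , f↦i = counted⇒block-of i counted
                       in subst (_∈ _) f↦i (∈-map⁺ block-of (complete (Vect-finite (suc s)) f)))
          (λ i∈ → let f , _ , i≡ = ∈-map⁻ block-of i∈ in subst Counted (sym i≡) (block-of-counted f)))

-- Imported here rather than at the top, where it would clash with the field's _*_ above.
open import Data.Nat using (_*_)

corollary8 : (q : ℕ) → IsPrimePower q → (F : FiniteField q) →
    (k n : ℕ) → 2 ≤ k → k ≤ n →
    (m : ℕ) (B : Fin m → LinAlg.Space F n) →
    LinAlg.IsSteiner F (k ∸ 1) k n m B →
    let open LinAlg F
        B′ : Fin m → Space (n ∸ 1)
        B′ i = shorten (B i)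
        inS̃ : Fin m → Set
        inS̃ i = HasDim (B′ i) (k ∸ 1)
    in
    -- the number of (k-1)-dimensional members of S' is [n-1,k-2]_q / [k-1,k-2]_q
    (Σ ℕ λ N → N * gauss q (k ∸ 1) (k ∸ 2) ≡ gauss q (n ∸ 1) (k ∸ 2)
               × ExactlyN inS̃ N)
    -- they are pairwise distinct
    × (∀ i j → inS̃ i → inS̃ j → B′ i ≐ B′ j → i ≡ j)
    -- they form an S_q(k-2,k-1,n-1)
    × (∀ (T : Space (n ∸ 1)) → HasDim T (k ∸ 2) →
         Σ (Fin m) λ i → inS̃ i × T ⊆ B′ i × (∀ j → inS̃ j → T ⊆ B′ j → j ≡ i))
    -- every other (k-1)-subspace lies in exactly q^(k-1) k-dim members of S'
    × (∀ (W : Space (n ∸ 1)) → HasDim W (k ∸ 1) →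
         (∀ i → inS̃ i → ¬ (W ≐ B′ i)) →
         ExactlyN (λ i → HasDim (B′ i) k × W ⊆ B′ i) (q ^ (k ∸ 1)))
corollary8 q _ F (suc (suc s)) (suc v) (s≤s (s≤s z≤n)) _ m B steiner =
  derived-count , derived-injective , derived-steiner , λ W W-dim W-new → NonDerived.exactly-q^[s+1] W-dim W-new
  where open Steiner F B steiner
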